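{- Let $p\ge3$ be prime, $G=E_p(p^3)=\langle a,b,c\mid a^p=b^p=c^p=1,[b,a]=c,[c,a]=1,[c,b]=1\rangle$, $H=\langle a\rangle$ and $H'_0=\langle a,c\rangle$. Then $$\mathrm{Ker}\{H^2(G,J_{G/H})\xrightarrow{\mathrm{res}}H^2(H'_0,J_{G/H})\}=0.$$
   Context: $[x,y]=x^{ -1}y^{ -1}xy$. $J_{G/H}$ is defined by the exact sequence of $G$-lattices $0\to\mathbb{Z}\to\mathbb{Z}[G/H]\to J_{G/H}\to0$, $1\mapsto\sum_{gH}gH$, with $\mathbb{Z}[G/H]$ the permutation lattice on left cosets. -}

module Defs where

open import Data.Nat as ℕ using (ℕ; NonZero)
open import Data.Nat.DivMod using (_mod_)
open import Data.Fin using (Fin; toℕ)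
open import Data.Integer as ℤ using (ℤ)
open import Data.Product using (Σ; _×_; _,_; ∃)
open import Relation.Binary.PropositionalEquality using (_≡_)

-- The extraspecial group E_p(p^3) = < a,b,c | a^p=b^p=c^p=1, [b,a]=c, [c,a]=[c,b]=1 >
-- with [x,y] = x⁻¹y⁻¹xy, realised by normal forms a^x b^y c^z  (x,y,z ∈ ℤ/p).
-- Since c is central and ba = abc, one gets b^y a^x' = a^x' b^y c^(x'y), hence
--   (a^x b^y c^z)(a^x' b^y' c^z') = a^(x+x') b^(y+y') c^(z+z'+x'y).
module Ep3 (p : ℕ) .{{nz : NonZero p}} where

  Zp : Set
  Zp = Fin p

  _⊕_ : Zp → Zp → Zp
  x ⊕ y = (toℕ x ℕ.+ toℕ y) mod p

  _⊗_ : Zp → Zp → Zp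
  x ⊗ y = (toℕ x ℕ.* toℕ y) mod p

  ⊖_ : Zp → Zp
  ⊖ x = (p ℕ.∸ toℕ x) mod p

  0p 1p : Zp
  0p = 0 mod p
  1p = 1 mod p

  G : Set
  G = Zp × Zp × Zp

  _·_ : G → G → G
  (x , y , z) · (x' , y' , z') = (x ⊕ x') , (y ⊕ y') , ((z ⊕ z') ⊕ (x' ⊗ y))

  e : G
  e = 0p , 0p , 0p

  _⁻¹ : G → G
  (x , y , z) ⁻¹ = (⊖ x) , (⊖ y) , ((⊖ z) ⊕ (x ⊗ y))

  a b c : G
  a = 1p , 0p , 0p
  b = 0p , 1p , 0p
  c = 0p , 0p , 1p

  _^_ : G → ℕ → G
  g ^ ℕ.zero = e
  g ^ ℕ.suc n = (g ^ n) · g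

  -- H = <a>,  H'₀ = <a , c>  (a and c commute, so <a,c> = { a^i c^j })
  InH : G → Set
  InH g = ∃ λ (k : ℕ) → g ≡ a ^ k

  InH'₀ : G → Set
  InH'₀ g = Σ ℕ λ i → Σ ℕ λ j → g ≡ (a ^ i) · (c ^ j)

  -- Z[G/H]: integer functions on G/H, i.e. functions G → ℤ constant on left cosets gH.
  -- The basis element kH is the indicator of kH; G acts by (g • f)(k) = f(g⁻¹ k),
  -- so that g • 1_{kH} = 1_{gkH}.
  Fun : Set
  Fun = G → ℤ

  IsCosetFun : Fun → Set
  IsCosetFun f = ∀ g h → InH h → f (g · h) ≡ f g

  _•_ : G → Fun → Fun
  (g • f) k = f ((g ⁻¹) · k)

  _+F_ _-F_ : Fun → Fun → Fun
  (f +F f') k = f k ℤ.+ f' k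
  (f -F f') k = f k ℤ.- f' k

  -- J_{G/H} = Z[G/H] / Z·(Σ_{gH} gH); the norm element is the constant function 1,
  -- so two elements of Z[G/H] are equal in J_{G/H} iff they differ by a constant.
  IsConst : Fun → Set
  IsConst f = Σ ℤ λ m → ∀ k → f k ≡ m

  _≈J_ : Fun → Fun → Set
  f ≈J f' = IsConst (f -F f')

  -- inhomogeneous cochains with values in J_{G/H} (represented by Z[G/H]-valued ones)
  1Cochain : Set
  1Cochain = G → Fun

  2Cochain : Set
  2Cochain = G → G → Fun

  Is1Cochain : 1Cochain → Set
  Is1Cochain φ = ∀ g → IsCosetFun (φ g)

  Is2Cochain : 2Cochain → Set
  Is2Cochain f = ∀ g₁ g₂ → IsCosetFun (f g₁ g₂)

  δ₂ : 2Cochain → G → G → G → Fun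
  δ₂ f g₁ g₂ g₃ =
    (((g₁ • f g₂ g₃) -F f (g₁ · g₂) g₃) +F f g₁ (g₂ · g₃)) -F f g₁ g₂

  δ₁ : 1Cochain → 2Cochain
  δ₁ φ g₁ g₂ = ((g₁ • φ g₂) -F φ (g₁ · g₂)) +F φ g₁

  Is2Cocycle : 2Cochain → Set
  Is2Cocycle f = Is2Cochain f × (∀ g₁ g₂ g₃ → δ₂ f g₁ g₂ g₃ ≈J (λ _ → ℤ.0ℤ))

  IsCoboundaryOnG : 2Cochain → Set
  IsCoboundaryOnG f =
    Σ 1Cochain λ φ → Is1Cochain φ × (∀ g₁ g₂ → f g₁ g₂ ≈J δ₁ φ g₁ g₂)

  -- res^G_{H'₀} f is a coboundary on H'₀ (the values of φ off H'₀ are irrelevant)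
  RestrictionIsCoboundary : 2Cochain → Set
  RestrictionIsCoboundary f =
    Σ 1Cochain λ φ → Is1Cochain φ ×
      (∀ g₁ g₂ → InH'₀ g₁ → InH'₀ g₂ → f g₁ g₂ ≈J δ₁ φ g₁ g₂)

  KerResTrivial : Set
  KerResTrivial =
    ∀ f → Is2Cocycle f → RestrictionIsCoboundary f → IsCoboundaryOnG f

-- Write N = ⟨a, c⟩ ≅ (ℤ/p)², so that G = N ⋊ ⟨b⟩. Subtracting the coboundary that trivialises the restriction,
-- we may assume that the 2-cocycle f vanishes on N × N. In the extension E = J ×_f G the map n ↦ (0, n) is then a
-- homomorphism on N, and it suffices to lift b to some b̂ = (β, b) that conjugates it correctly and has b̂ᵖ = 1:
-- n bʸ ↦ (0, n) b̂ʸ is then a homomorphic section of E → G, and its J-part exhibits f as a coboundary.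
-- Conjugating correctly means β − n β = R(n) for the 1-cocycle R(n) = f(n, b) − f(b, b⁻¹ n b) of N, so the key
-- input is H¹(N, J) = 0; afterwards b̂ᵖ = (t, 1) with t fixed by b and c, and J^G = 0 forces t = 0.
-- H¹(N, J) = 0 is checked on the rows {y = const} of G/H ≅ (ℤ/p)²: c shifts every row cyclically, a⁻¹ fixes row 0
-- and ac fixes row 1, so comparing two rows makes the norm of R(c) divisible by p, hence R(c) a c-coboundary;
-- R(a) follows because a acts on each row as a power of c.

module Submission where

open import Defs
open import Level using (0ℓ)
open import Data.Nat as ℕ using (ℕ; NonZero; _≤_; zero; suc)
open import Data.Nat.Primality using (Prime)
import Data.Nat.Properties as ℕ
import Data.Nat.Divisibility as ℕ
open import Data.Nat.DivMod using (_mod_; _%_; _/_; m≡m%n+[m/n]*n; m%n<n)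
open import Data.Fin as Fin using (toℕ; fromℕ<)
import Data.Fin.Properties as Fin
open import Data.Integer as ℤ using (ℤ; +_; -_; _+_; _*_; _-_; ∣_∣)
import Data.Integer.Properties as ℤ
open import Data.Integer.DivMod using (_%ℕ_; _/ℕ_; n%ℕd<d; a≡a%ℕn+[a/ℕn]*n)
open import Data.Integer.Divisibility.Signed using (_∣_; ∣⇒∣ᵤ; ∣m∣n⇒∣m+n; ∣m⇒∣-m; ∣n⇒∣m*n; ∣m⇒∣m*n; divides)
open import Data.Integer.Tactic.RingSolver using (solve-∀)
open import Data.Maybe using (map)
open import Data.Product using (_×_; _,_; proj₁; proj₂)
open import Relation.Nullary.Decidable using (dec⇒maybe)
open import Relation.Binary.Bundles using (Setoid)
import Relation.Binary.Reasoning.Setoid as SetoidReasoning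
open import Relation.Binary.PropositionalEquality
  using (_≡_; refl; sym; trans; cong; cong₂; subst; isEquivalence; module ≡-Reasoning)
open import Data.Empty using (⊥-elim)
open import Data.Unit using (⊤; tt)
open import Algebra.Bundles using (CommutativeRing; Group)
import Algebra.Properties.Group as GroupProperties
open import Algebra.Structures using (IsCommutativeRing)
open import Algebra.Solver.Ring.AlmostCommutativeRing
  using (AlmostCommutativeRing; fromCommutativeRing; _-Raw-AlmostCommutative⟶_)

module _ (p : ℕ) {{_ : NonZero p}} where

  open Ep3 p

  infix 4 _≡_[modp]
  record _≡_[modp] (i j : ℤ) : Set where
    constructor modp
    field p∣i-j : + p ∣ i - j
  open _≡_[modp]

  modp-reflexive : ∀ {i j} → i ≡ j → i ≡ j [modp]
  modp-reflexive {i} refl = modp (divides (+ 0) (ℤ.+-inverseʳ i))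

  modp-refl : ∀ {i} → i ≡ i [modp]
  modp-refl {i} = modp-reflexive {i} refl

  modp-trans : ∀ {i j k} → i ≡ j [modp] → j ≡ k [modp] → i ≡ k [modp]
  modp-trans {i} {j} {k} (modp h) (modp h′) = modp (subst (+ p ∣_) (telescope i j k) (∣m∣n⇒∣m+n h h′))
    where telescope : ∀ i j k → (i - j) + (j - k) ≡ i - k
          telescope = solve-∀

  modp-sym : ∀ {i j} → i ≡ j [modp] → j ≡ i [modp]
  modp-sym {i} {j} (modp h) = modp (subst (+ p ∣_) (negate i j) (∣m⇒∣-m h))
    where negate : ∀ i j → - (i - j) ≡ j - i
          negate = solve-∀

  +-cong-modp : ∀ {i j i′ j′} → i ≡ j [modp] → i′ ≡ j′ [modp] → i + i′ ≡ j + j′ [modp]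
  +-cong-modp {i} {j} {i′} {j′} (modp h) (modp h′) = modp (subst (+ p ∣_) (regroup i j i′ j′) (∣m∣n⇒∣m+n h h′))
    where regroup : ∀ i j i′ j′ → (i - j) + (i′ - j′) ≡ (i + i′) - (j + j′)
          regroup = solve-∀

  *-cong-modp : ∀ {i j i′ j′} → i ≡ j [modp] → i′ ≡ j′ [modp] → i * i′ ≡ j * j′ [modp]
  *-cong-modp {i} {j} {i′} {j′} (modp h) (modp h′) =
    modp (subst (+ p ∣_) (regroup i j i′ j′) (∣m∣n⇒∣m+n (∣n⇒∣m*n i h′) (∣m⇒∣m*n j′ h)))
    where regroup : ∀ i j i′ j′ → i * (i′ - j′) + (i - j) * j′ ≡ i * i′ - j * j′
          regroup = solve-∀

  neg-cong-modp : ∀ {i j} → i ≡ j [modp] → - i ≡ - j [modp]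
  neg-cong-modp {i} {j} (modp h) = modp (subst (+ p ∣_) (negate i j) (∣m⇒∣-m h))
    where negate : ∀ i j → - (i - j) ≡ - i - - j
          negate = solve-∀

  ⟦_⟧ : Zp → ℤ
  ⟦ x ⟧ = + toℕ x

  infix 4 _isResidueOf_
  record _isResidueOf_ (x : Zp) (i : ℤ) : Set where
    constructor residue
    field ⟦x⟧≡i : ⟦ x ⟧ ≡ i [modp]

  -- On i = + n this is definitionally n mod p, so _⊕_, _⊗_, 0p and 1p of Defs are literally values of π.
  π : ℤ → Zp
  π i = fromℕ< (n%ℕd<d i p)

  π-residue : ∀ i → π i isResidueOf i
  π-residue i = residue (modp (divides (- (i /ℕ p)) (begin
      ⟦ π i ⟧ - i                                 ≡⟨ cong (λ n → + n - i) (Fin.toℕ-fromℕ< (n%ℕd<d i p)) ⟩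
      + (i %ℕ p) - i                              ≡⟨ cong (λ j → + (i %ℕ p) - j) (a≡a%ℕn+[a/ℕn]*n i p) ⟩
      + (i %ℕ p) - (+ (i %ℕ p) + (i /ℕ p) * + p)  ≡⟨ cancel (+ (i %ℕ p)) (i /ℕ p) (+ p) ⟩
      - (i /ℕ p) * + p                            ∎)))
    where open ≡-Reasoning
          cancel : ∀ r q P → r - (r + q * P) ≡ - q * P
          cancel = solve-∀

  0p-residue : 0p isResidueOf + 0
  0p-residue = π-residue (+ 0)

  1p-residue : 1p isResidueOf + 1
  1p-residue = π-residue (+ 1)

  toℤ-residue : ∀ x → x isResidueOf ⟦ x ⟧
  toℤ-residue x = residue modp-refl

  residue-≡ : ∀ {x i j} → x isResidueOf i → i ≡ j [modp] → x isResidueOf j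
  residue-≡ (residue h) i≡j = residue (modp-trans h i≡j)

  p≡0-modp : + p ≡ + 0 [modp]
  p≡0-modp = modp (divides (+ 1) (trans (ℤ.+-identityʳ (+ p)) (sym (ℤ.*-identityˡ (+ p)))))

  ⊕-residue : ∀ {x y i j} → x isResidueOf i → y isResidueOf j → x ⊕ y isResidueOf i + j
  ⊕-residue {x} {y} (residue hx) (residue hy) =
    residue-≡ (π-residue (+ (toℕ x ℕ.+ toℕ y)))
              (modp-trans (modp-reflexive (ℤ.pos-+ (toℕ x) (toℕ y))) (+-cong-modp hx hy))

  ⊗-residue : ∀ {x y i j} → x isResidueOf i → y isResidueOf j → x ⊗ y isResidueOf i * j
  ⊗-residue {x} {y} (residue hx) (residue hy) =
    residue-≡ (π-residue (+ (toℕ x ℕ.* toℕ y)))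
              (modp-trans (modp-reflexive (ℤ.pos-* (toℕ x) (toℕ y))) (*-cong-modp hx hy))

  ⊖-residue : ∀ {x i} → x isResidueOf i → ⊖ x isResidueOf - i
  ⊖-residue {x} (residue hx) = residue-≡ (π-residue (+ (p ℕ.∸ toℕ x)))
    (modp-trans (modp-reflexive p∸x)
                (modp-trans (+-cong-modp p≡0-modp (neg-cong-modp hx)) (modp-reflexive (ℤ.+-identityˡ _))))
    where p∸x : + (p ℕ.∸ toℕ x) ≡ + p - ⟦ x ⟧
          p∸x = trans (sym (ℤ.⊖-≥ (ℕ.<⇒≤ (Fin.toℕ<n x)))) (sym (ℤ.m-n≡m⊖n p (toℕ x)))

  residue-unique : ∀ {x y i} → x isResidueOf i → y isResidueOf i → x ≡ y
  residue-unique {x} {y} (residue hx) (residue hy) =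
    Fin.toℕ-injective (ℤ.+-injective (ℤ.i-j≡0⇒i≡j ⟦ x ⟧ ⟦ y ⟧ (ℤ.∣i∣≡0⇒i≡0 ∣x-y∣≡0)))
    where
      small-multiple : ∀ {d} → p ℕ.∣ d → d ℕ.< p → d ≡ 0
      small-multiple {zero}  _   _   = refl
      small-multiple {suc d} p∣d d<p = ⊥-elim (ℕ.<⇒≱ d<p (ℕ.∣⇒≤ p∣d))
      ∣x-y∣<p : ∣ ⟦ x ⟧ - ⟦ y ⟧ ∣ ℕ.< p
      ∣x-y∣<p = ℕ.≤-<-trans (subst (ℕ._≤ toℕ x ℕ.⊔ toℕ y) (cong ∣_∣ (sym (ℤ.m-n≡m⊖n (toℕ x) (toℕ y))))
                                   (ℤ.∣m⊝n∣≤m⊔n (toℕ x) (toℕ y)))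
                            (ℕ.⊔-lub (Fin.toℕ<n x) (Fin.toℕ<n y))
      ∣x-y∣≡0 : ∣ ⟦ x ⟧ - ⟦ y ⟧ ∣ ≡ 0
      ∣x-y∣≡0 = small-multiple (∣⇒∣ᵤ (p∣i-j (modp-trans hx (modp-sym hy)))) ∣x-y∣<p

  residue-lift : ∀ {x y i j} → x isResidueOf i → y isResidueOf j → i ≡ j → x ≡ y
  residue-lift hx hy refl = residue-unique hx hy

  toℕ-of-residue : ∀ {x n} → x isResidueOf + n → n ℕ.< p → toℕ x ≡ n
  toℕ-of-residue {x} {n} hx n<p = trans (cong toℕ (residue-unique hx fromℕ<-residue)) (Fin.toℕ-fromℕ< n<p)
    where fromℕ<-residue : fromℕ< n<p isResidueOf + n
          fromℕ<-residue = subst (fromℕ< n<p isResidueOf_) (cong +_ (Fin.toℕ-fromℕ< n<p)) (toℤ-residue (fromℕ< n<p))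

  toℕ-⊖1-suc : ∀ {x w} → toℕ x ≡ suc w → toℕ (x ⊕ (⊖ 1p)) ≡ w
  toℕ-⊖1-suc {x} {w} x≡1+w = toℕ-of-residue
    (residue-≡ (⊕-residue (toℤ-residue x) (⊖-residue 1p-residue))
               (modp-reflexive (trans (cong (λ n → + n + - + 1) x≡1+w) (cancel (+ w)))))
    (ℕ.<-trans (ℕ.n<1+n w) (subst (ℕ._< p) x≡1+w (Fin.toℕ<n x)))
    where cancel : ∀ w → (+ 1 + w) + - + 1 ≡ w
          cancel = solve-∀

  toℕ-⊖1-zero : ∀ {x} → toℕ x ≡ 0 → toℕ (x ⊕ (⊖ 1p)) ≡ ℕ.pred p
  toℕ-⊖1-zero {x} x≡0 = toℕ-of-residue
    (residue-≡ (⊕-residue (toℤ-residue x) (⊖-residue 1p-residue))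
               (modp-trans (modp-reflexive (cong (λ n → + n + - + 1) x≡0)) -1≡p-1))
    (subst (ℕ.pred p ℕ.<_) (ℕ.suc-pred p) ℕ.≤-refl)
    where
      -1≡p-1 : + 0 + - + 1 ≡ + ℕ.pred p [modp]
      -1≡p-1 = modp (divides (- + 1) (trans (wrap (+ ℕ.pred p)) (cong (λ n → - + 1 * + n) (ℕ.suc-pred p))))
        where wrap : ∀ q → (+ 0 + - + 1) - q ≡ - + 1 * (+ 1 + q)
              wrap = solve-∀

  [_] : ℕ → Zp
  [ j ] = j mod p

  [suc] : ∀ j → [ suc j ] ≡ 1p ⊕ [ j ]
  [suc] j = residue-lift (π-residue (+ suc j)) (⊕-residue 1p-residue (π-residue (+ j))) (ℤ.pos-+ 1 j)

  [toℕ] : ∀ x → [ toℕ x ] ≡ x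
  [toℕ] x = residue-lift (π-residue ⟦ x ⟧) (toℤ-residue x) refl

  [p]≡0 : [ p ] ≡ 0p
  [p]≡0 = residue-unique (residue-≡ (π-residue (+ p)) p≡0-modp) 0p-residue

  p*-injective : ∀ {i j} → + p * i ≡ + p * j → i ≡ j
  p*-injective {i} {j} = ℤ.*-cancelˡ-≡ (+ p) i j

  Zp-isCommutativeRing : IsCommutativeRing _≡_ _⊕_ _⊗_ ⊖_ 0p 1p
  Zp-isCommutativeRing = record
    { isRing = record
      { +-isAbelianGroup = record
        { isGroup = record
          { isMonoid = record
            { isSemigroup = record
              { isMagma = record { isEquivalence = isEquivalence ; ∙-cong = cong₂ _⊕_ }
              ; assoc = λ x y z → residue-lift (⊕-residue (⊕-residue (r x) (r y)) (r z))
                                               (⊕-residue (r x) (⊕-residue (r y) (r z)))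
                                               (ℤ.+-assoc ⟦ x ⟧ ⟦ y ⟧ ⟦ z ⟧)
              }
            ; identity = (λ x → residue-lift (⊕-residue 0p-residue (r x)) (r x) (ℤ.+-identityˡ ⟦ x ⟧))
                       , (λ x → residue-lift (⊕-residue (r x) 0p-residue) (r x) (ℤ.+-identityʳ ⟦ x ⟧))
            }
          ; inverse = (λ x → residue-lift (⊕-residue (⊖-residue (r x)) (r x)) 0p-residue (ℤ.+-inverseˡ ⟦ x ⟧))
                    , (λ x → residue-lift (⊕-residue (r x) (⊖-residue (r x))) 0p-residue (ℤ.+-inverseʳ ⟦ x ⟧))
          ; ⁻¹-cong = cong ⊖_
          }
        ; comm = λ x y → residue-lift (⊕-residue (r x) (r y)) (⊕-residue (r y) (r x)) (ℤ.+-comm ⟦ x ⟧ ⟦ y ⟧)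
        }
      ; *-cong = cong₂ _⊗_
      ; *-assoc = λ x y z → residue-lift (⊗-residue (⊗-residue (r x) (r y)) (r z))
                                         (⊗-residue (r x) (⊗-residue (r y) (r z)))
                                         (ℤ.*-assoc ⟦ x ⟧ ⟦ y ⟧ ⟦ z ⟧)
      ; *-identity = (λ x → residue-lift (⊗-residue 1p-residue (r x)) (r x) (ℤ.*-identityˡ ⟦ x ⟧))
                   , (λ x → residue-lift (⊗-residue (r x) 1p-residue) (r x) (ℤ.*-identityʳ ⟦ x ⟧))
      ; distrib = (λ x y z → residue-lift (⊗-residue (r x) (⊕-residue (r y) (r z)))
                                          (⊕-residue (⊗-residue (r x) (r y)) (⊗-residue (r x) (r z)))
                                          (ℤ.*-distribˡ-+ ⟦ x ⟧ ⟦ y ⟧ ⟦ z ⟧))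
                , (λ x y z → residue-lift (⊗-residue (⊕-residue (r y) (r z)) (r x))
                                          (⊕-residue (⊗-residue (r y) (r x)) (⊗-residue (r z) (r x)))
                                          (ℤ.*-distribʳ-+ ⟦ x ⟧ ⟦ y ⟧ ⟦ z ⟧))
      }
    ; *-comm = λ x y → residue-lift (⊗-residue (r x) (r y)) (⊗-residue (r y) (r x)) (ℤ.*-comm ⟦ x ⟧ ⟦ y ⟧)
    }
    where r = toℤ-residue

  Zp-commutativeRing : CommutativeRing 0ℓ 0ℓ
  Zp-commutativeRing = record { isCommutativeRing = Zp-isCommutativeRing }

  Zp-ring : AlmostCommutativeRing 0ℓ 0ℓ
  Zp-ring = fromCommutativeRing Zp-commutativeRing

  π-homomorphism : ℤ.+-*-rawRing -Raw-AlmostCommutative⟶ Zp-ring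
  π-homomorphism = record
    { ⟦_⟧ = π
    ; +-homo = λ i j → residue-lift (π-residue (i + j)) (⊕-residue (π-residue i) (π-residue j)) refl
    ; *-homo = λ i j → residue-lift (π-residue (i * j)) (⊗-residue (π-residue i) (π-residue j)) refl
    ; -‿homo = λ i → residue-lift (π-residue (- i)) (⊖-residue (π-residue i)) refl
    ; 0-homo = refl
    ; 1-homo = refl
    }

  open import Algebra.Solver.Ring ℤ.+-*-rawRing Zp-ring π-homomorphism
    (λ i j → map (cong π) (dec⇒maybe (i ℤ.≟ j)))
    using (solve; _:=_; _:+_; _:*_; :-_; con; Polynomial)

  module Zp = CommutativeRing Zp-commutativeRing

  -- The group law transcribed to solver polynomials: a Gᴾ-expression evaluates definitionally to the coordinates of
  -- the corresponding product in G, so identities between coordinates are closed by a single call to solve.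
  Gᴾ : ℕ → Set
  Gᴾ n = Polynomial n × Polynomial n × Polynomial n

  infixl 7 _·ᴾ_
  _·ᴾ_ : ∀ {n} → Gᴾ n → Gᴾ n → Gᴾ n
  (x , y , z) ·ᴾ (x′ , y′ , z′) = (x :+ x′) , (y :+ y′) , ((z :+ z′) :+ (x′ :* y))

  _⁻¹ᴾ : ∀ {n} → Gᴾ n → Gᴾ n
  (x , y , z) ⁻¹ᴾ = (:- x) , (:- y) , ((:- z) :+ (x :* y))

  o ı : ∀ {n} → Polynomial n
  o = con (+ 0)
  ı = con (+ 1)

  eᴾ aᴾ cᴾ : ∀ {n} → Gᴾ n
  eᴾ = o , o , o
  aᴾ = ı , o , o
  cᴾ = o , o , ı

  zᴾ : ∀ {n} → Gᴾ n → Polynomial n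
  zᴾ (x , y , z) = z

  yᴾ : ∀ {n} → Gᴾ n → Polynomial n
  yᴾ (x , y , z) = y

  Wᴾ : ∀ {n} → Gᴾ n → Polynomial n
  Wᴾ (x , y , z) = z :+ (:- (x :* y))

  ≡-triple : ∀ {x y z x′ y′ z′ : Zp} → x ≡ x′ → y ≡ y′ → z ≡ z′ →
             _≡_ {A = G} (x , y , z) (x′ , y′ , z′)
  ≡-triple refl refl refl = refl

  ·-assoc : ∀ g h k → (g · h) · k ≡ g · (h · k)
  ·-assoc (x , y , z) (x′ , y′ , z′) (x″ , y″ , z″) = ≡-triple (Zp.+-assoc x x′ x″) (Zp.+-assoc y y′ y″)
    (solve 9 (λ x y z x′ y′ z′ x″ y″ z″ →
                zᴾ (((x , y , z) ·ᴾ (x′ , y′ , z′)) ·ᴾ (x″ , y″ , z″)) := zᴾ ((x , y , z) ·ᴾ ((x′ , y′ , z′) ·ᴾ (x″ , y″ , z″))))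
             refl x y z x′ y′ z′ x″ y″ z″)

  ·-identityˡ : ∀ g → e · g ≡ g
  ·-identityˡ (x , y , z) = ≡-triple (Zp.+-identityˡ x) (Zp.+-identityˡ y)
    (solve 3 (λ x y z → zᴾ (eᴾ ·ᴾ (x , y , z)) := z) refl x y z)

  ·-identityʳ : ∀ g → g · e ≡ g
  ·-identityʳ (x , y , z) = ≡-triple (Zp.+-identityʳ x) (Zp.+-identityʳ y)
    (solve 3 (λ x y z → zᴾ ((x , y , z) ·ᴾ eᴾ) := z) refl x y z)

  ·-inverseˡ : ∀ g → (g ⁻¹) · g ≡ e
  ·-inverseˡ (x , y , z) = ≡-triple (Zp.-‿inverseˡ x) (Zp.-‿inverseˡ y)
    (solve 3 (λ x y z → zᴾ ((x , y , z) ⁻¹ᴾ ·ᴾ (x , y , z)) := o) refl x y z)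

  ·-inverseʳ : ∀ g → g · (g ⁻¹) ≡ e
  ·-inverseʳ (x , y , z) = ≡-triple (Zp.-‿inverseʳ x) (Zp.-‿inverseʳ y)
    (solve 3 (λ x y z → zᴾ ((x , y , z) ·ᴾ (x , y , z) ⁻¹ᴾ) := o) refl x y z)

  G-group : Group 0ℓ 0ℓ
  G-group = record
    { isGroup = record
      { isMonoid = record
        { isSemigroup = record
          { isMagma = record { isEquivalence = isEquivalence ; ∙-cong = cong₂ _·_ }
          ; assoc = ·-assoc
          }
        ; identity = ·-identityˡ , ·-identityʳ
        }
      ; inverse = ·-inverseˡ , ·-inverseʳ
      ; ⁻¹-cong = cong _⁻¹
      }
    }

  open GroupProperties G-group public
    using ( ⁻¹-anti-homo-∙; ⁻¹-involutive; ε⁻¹≈ε; \\-leftDividesˡ; \\-leftDividesʳ; //-rightDividesˡ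
          ; ∙-cancelʳ)

  ⁻¹-·-act : ∀ g h k → (h ⁻¹) · ((g ⁻¹) · k) ≡ ((g · h) ⁻¹) · k
  ⁻¹-·-act g h k = trans (sym (·-assoc (h ⁻¹) (g ⁻¹) k)) (cong (_· k) (sym (⁻¹-anti-homo-∙ g h)))

  e⁻¹-act : ∀ k → (e ⁻¹) · k ≡ k
  e⁻¹-act k = trans (cong (_· k) ε⁻¹≈ε) (·-identityˡ k)

  ^-scalar : ∀ {x y z} → x ⊗ y ≡ 0p → ∀ j → (x , y , z) ^ j ≡ ([ j ] ⊗ x , [ j ] ⊗ y , [ j ] ⊗ z)
  ^-scalar {x} {y} {z} xy≡0 zero = sym (≡-triple (Zp.zeroˡ x) (Zp.zeroˡ y) (Zp.zeroˡ z))
  ^-scalar {x} {y} {z} xy≡0 (suc j) = begin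
    ((x , y , z) ^ j) · (x , y , z)
      ≡⟨ cong (_· (x , y , z)) (^-scalar xy≡0 j) ⟩
    (([ j ] ⊗ x) ⊕ x , ([ j ] ⊗ y) ⊕ y , (([ j ] ⊗ z) ⊕ z) ⊕ (x ⊗ ([ j ] ⊗ y)))
      ≡⟨ ≡-triple (step x) (step y) third ⟩
    ((1p ⊕ [ j ]) ⊗ x , (1p ⊕ [ j ]) ⊗ y , (1p ⊕ [ j ]) ⊗ z)
      ≡⟨ cong (λ s → (s ⊗ x , s ⊗ y , s ⊗ z)) (sym ([suc] j)) ⟩
    ([ suc j ] ⊗ x , [ suc j ] ⊗ y , [ suc j ] ⊗ z)
      ∎
    where
      open ≡-Reasoning
      step : ∀ u → ([ j ] ⊗ u) ⊕ u ≡ (1p ⊕ [ j ]) ⊗ u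
      step = solve 2 (λ J u → (J :* u) :+ u := (ı :+ J) :* u) refl [ j ]
      third : (([ j ] ⊗ z) ⊕ z) ⊕ (x ⊗ ([ j ] ⊗ y)) ≡ (1p ⊕ [ j ]) ⊗ z
      third = begin
        (([ j ] ⊗ z) ⊕ z) ⊕ (x ⊗ ([ j ] ⊗ y))
          ≡⟨ solve 4 (λ J x y z → ((J :* z) :+ z) :+ (x :* (J :* y)) := ((ı :+ J) :* z) :+ (J :* (x :* y))) refl [ j ] x y z ⟩
        ((1p ⊕ [ j ]) ⊗ z) ⊕ ([ j ] ⊗ (x ⊗ y))
          ≡⟨ cong (λ w → ((1p ⊕ [ j ]) ⊗ z) ⊕ ([ j ] ⊗ w)) xy≡0 ⟩
        ((1p ⊕ [ j ]) ⊗ z) ⊕ ([ j ] ⊗ 0p)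
          ≡⟨ solve 2 (λ J z → ((ı :+ J) :* z) :+ (J :* o) := (ı :+ J) :* z) refl [ j ] z ⟩
        (1p ⊕ [ j ]) ⊗ z
          ∎

  a^-coords : ∀ j → a ^ j ≡ ([ j ] , 0p , 0p)
  a^-coords j = trans (^-scalar (Zp.zeroʳ 1p) j) (≡-triple (Zp.*-identityʳ [ j ]) (Zp.zeroʳ [ j ]) (Zp.zeroʳ [ j ]))

  b^-coords : ∀ j → b ^ j ≡ (0p , [ j ] , 0p)
  b^-coords j = trans (^-scalar (Zp.zeroˡ 1p) j) (≡-triple (Zp.zeroʳ [ j ]) (Zp.*-identityʳ [ j ]) (Zp.zeroʳ [ j ]))

  c^-coords : ∀ j → c ^ j ≡ (0p , 0p , [ j ])
  c^-coords j = trans (^-scalar (Zp.zeroˡ 0p) j) (≡-triple (Zp.zeroʳ [ j ]) (Zp.zeroʳ [ j ]) (Zp.*-identityʳ [ j ]))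

  a^toℕ : ∀ x → a ^ toℕ x ≡ (x , 0p , 0p)
  a^toℕ x = trans (a^-coords (toℕ x)) (cong (λ s → (s , 0p , 0p)) ([toℕ] x))

  b^toℕ : ∀ y → b ^ toℕ y ≡ (0p , y , 0p)
  b^toℕ y = trans (b^-coords (toℕ y)) (cong (λ s → (0p , s , 0p)) ([toℕ] y))

  c^toℕ : ∀ z → c ^ toℕ z ≡ (0p , 0p , z)
  c^toℕ z = trans (c^-coords (toℕ z)) (cong (λ s → (0p , 0p , s)) ([toℕ] z))

  ^-comm : ∀ g m → g · (g ^ m) ≡ (g ^ m) · g
  ^-comm g zero    = trans (·-identityʳ g) (sym (·-identityˡ g))
  ^-comm g (suc m) = trans (sym (·-assoc g (g ^ m) g)) (cong (_· g) (^-comm g m))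

  -- The coset kH = {(x + i , y , z + i y)} is determined by yC k and WC k (= z − x y).
  xC yC WC : G → Zp
  xC (x , y , z) = x
  yC (x , y , z) = y
  WC (x , y , z) = z ⊕ (⊖ (x ⊗ y))

  ^p≡e : ∀ {x y z} → x ⊗ y ≡ 0p → (x , y , z) ^ p ≡ e
  ^p≡e {x} {y} {z} xy≡0 = begin
    (x , y , z) ^ p                          ≡⟨ ^-scalar xy≡0 p ⟩
    ([ p ] ⊗ x , [ p ] ⊗ y , [ p ] ⊗ z)      ≡⟨ cong (λ s → (s ⊗ x , s ⊗ y , s ⊗ z)) [p]≡0 ⟩
    (0p ⊗ x , 0p ⊗ y , 0p ⊗ z)               ≡⟨ ≡-triple (Zp.zeroˡ x) (Zp.zeroˡ y) (Zp.zeroˡ z) ⟩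
    e                                        ∎
    where open ≡-Reasoning

  b^p≡e : b ^ p ≡ e
  b^p≡e = ^p≡e (Zp.zeroˡ 1p)

  conj : G → G → G
  conj g n = g · (n · (g ⁻¹))

  ·-conj : ∀ g n → g · n ≡ conj g n · g
  ·-conj g n = sym (begin
    (g · (n · (g ⁻¹))) · g     ≡⟨ ·-assoc g (n · (g ⁻¹)) g ⟩
    g · ((n · (g ⁻¹)) · g)     ≡⟨ cong (g ·_) (//-rightDividesˡ g n) ⟩
    g · n                      ∎)
    where open ≡-Reasoning

  ·-conj⁻¹ : ∀ g n → g · conj (g ⁻¹) n ≡ n · g
  ·-conj⁻¹ g n = trans (\\-leftDividesˡ g (n · ((g ⁻¹) ⁻¹))) (cong (n ·_) (⁻¹-involutive g))

  conj-hom : ∀ g n₁ n₂ → conj g (n₁ · n₂) ≡ conj g n₁ · conj g n₂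
  conj-hom g n₁ n₂ = ∙-cancelʳ g (conj g (n₁ · n₂)) (conj g n₁ · conj g n₂) (begin
    conj g (n₁ · n₂) · g             ≡⟨ ·-conj g (n₁ · n₂) ⟨
    g · (n₁ · n₂)                    ≡⟨ ·-assoc g n₁ n₂ ⟨
    (g · n₁) · n₂                    ≡⟨ cong (_· n₂) (·-conj g n₁) ⟩
    (conj g n₁ · g) · n₂             ≡⟨ ·-assoc (conj g n₁) g n₂ ⟩
    conj g n₁ · (g · n₂)             ≡⟨ cong (conj g n₁ ·_) (·-conj g n₂) ⟩
    conj g n₁ · (conj g n₂ · g)      ≡⟨ ·-assoc (conj g n₁) (conj g n₂) g ⟨
    (conj g n₁ · conj g n₂) · g      ∎)
    where open ≡-Reasoning

  conj-e : ∀ n → conj e n ≡ n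
  conj-e n = trans (·-identityˡ (n · (e ⁻¹))) (trans (cong (n ·_) ε⁻¹≈ε) (·-identityʳ n))

  conj-· : ∀ g h n → conj g (conj h n) ≡ conj (g · h) n
  conj-· g h n = begin
    g · ((h · (n · (h ⁻¹))) · (g ⁻¹))    ≡⟨ cong (g ·_) (·-assoc h (n · (h ⁻¹)) (g ⁻¹)) ⟩
    g · (h · ((n · (h ⁻¹)) · (g ⁻¹)))    ≡⟨ ·-assoc g h ((n · (h ⁻¹)) · (g ⁻¹)) ⟨
    (g · h) · ((n · (h ⁻¹)) · (g ⁻¹))    ≡⟨ cong ((g · h) ·_) (·-assoc n (h ⁻¹) (g ⁻¹)) ⟩
    (g · h) · (n · ((h ⁻¹) · (g ⁻¹)))    ≡⟨ cong (λ k → (g · h) · (n · k)) (⁻¹-anti-homo-∙ g h) ⟨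
    (g · h) · (n · ((g · h) ⁻¹))         ∎
    where open ≡-Reasoning

  conj-inverse : ∀ g n → conj (g ⁻¹) (conj g n) ≡ n
  conj-inverse g n = trans (conj-· (g ⁻¹) g n) (trans (cong (λ h → conj h n) (·-inverseˡ g)) (conj-e n))

  -- The normal subgroup N = ⟨a, c⟩ = H'₀

  record InN (g : G) : Set where
    constructor inN
    field y≡0 : yC g ≡ 0p

  e∈N : InN e
  e∈N = inN refl

  a∈N : InN a
  a∈N = inN refl

  c∈N : InN c
  c∈N = inN refl

  InN-· : ∀ {g h} → InN g → InN h → InN (g · h)
  InN-· {_ , _ , _} {_ , _ , _} (inN refl) (inN refl) = inN (Zp.+-identityˡ 0p)

  InN-⁻¹ : ∀ {g} → InN g → InN (g ⁻¹)
  InN-⁻¹ {_ , _ , _} (inN refl) = inN (residue-lift (⊖-residue 0p-residue) 0p-residue refl)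

  InN-^ : ∀ {g} → InN g → ∀ m → InN (g ^ m)
  InN-^ g∈N zero    = inN refl
  InN-^ g∈N (suc m) = InN-· (InN-^ g∈N m) g∈N

  InN⇒^p≡e : ∀ {g} → InN g → g ^ p ≡ e
  InN⇒^p≡e {x , _ , _} (inN refl) = ^p≡e (Zp.zeroʳ x)

  InN⇒InH'₀ : ∀ {g} → InN g → InH'₀ g
  InN⇒InH'₀ {x , _ , z} (inN refl) = toℕ x , toℕ z , sym (begin
    (a ^ toℕ x) · (c ^ toℕ z)              ≡⟨ cong₂ _·_ (a^toℕ x) (c^toℕ z) ⟩
    (x , 0p , 0p) · (0p , 0p , z)          ≡⟨ ≡-triple (Zp.+-identityʳ x) (Zp.+-identityˡ 0p)
                                                (solve 2 (λ x z → zᴾ ((x , o , o) ·ᴾ (o , o , z)) := z) refl x z) ⟩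
    (x , 0p , z)                           ∎)
    where open ≡-Reasoning

  InN-conj : ∀ g {n} → InN n → InN (conj g n)
  InN-conj (x , y , z) {x′ , _ , z′} (inN refl) = inN
    (solve 5 (λ x y z x′ z′ → yᴾ ((x , y , z) ·ᴾ ((x′ , o , z′) ·ᴾ (x , y , z) ⁻¹ᴾ)) := o) refl x y z x′ z′)

  nPart : G → G
  nPart (x , y , z) = (x , 0p , z)

  nPart∈N : ∀ g → InN (nPart g)
  nPart∈N (x , y , z) = inN refl

  yℕ : G → ℕ
  yℕ g = toℕ (yC g)

  nPart-decomposition : ∀ g → nPart g · (b ^ yℕ g) ≡ g
  nPart-decomposition (x , y , z) = trans (cong ((x , 0p , z) ·_) (b^toℕ y))
    (≡-triple (Zp.+-identityʳ x) (Zp.+-identityˡ y) (solve 3 (λ x y z → zᴾ ((x , o , z) ·ᴾ (o , y , o)) := z) refl x y z))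

  yℕ-· : ∀ g h → yℕ (g · h) ≡ (yℕ g ℕ.+ yℕ h) % p
  yℕ-· g h = Fin.toℕ-fromℕ< (m%n<n (yℕ g ℕ.+ yℕ h) p)

  coset-rep : ∀ k → k ≡ (0p , yC k , WC k) · (a ^ toℕ (xC k))
  coset-rep (x , y , z) = sym (begin
    (0p , y , W) · (a ^ toℕ x)        ≡⟨ cong (λ g → (0p , y , W) · g) (a^toℕ x) ⟩
    (0p , y , W) · (x , 0p , 0p)      ≡⟨ ≡-triple (Zp.+-identityˡ x) (Zp.+-identityʳ y)
                                           (solve 3 (λ x y z → zᴾ ((o , y , Wᴾ (x , y , z)) ·ᴾ (x , o , o)) := z) refl x y z) ⟩
    (x , y , z)                       ∎)
    where open ≡-Reasoning
          W = WC (x , y , z)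

  coset-fun-base : ∀ {F} → IsCosetFun F → ∀ k → F k ≡ F (0p , yC k , WC k)
  coset-fun-base {F} F-coset k = trans (cong F (coset-rep k)) (F-coset _ _ (toℕ (xC k) , refl))

  coset-fun-≡ : ∀ {F} → IsCosetFun F → ∀ {k k′} → yC k ≡ yC k′ → WC k ≡ WC k′ → F k ≡ F k′
  coset-fun-≡ {F} F-coset {k} {k′} y≡ W≡ =
    trans (coset-fun-base F-coset k)
          (trans (cong₂ (λ y W → F (0p , y , W)) y≡ W≡) (sym (coset-fun-base F-coset k′)))

  yC-N· : ∀ {n} → InN n → ∀ k → yC (n · k) ≡ yC k
  yC-N· {_ , _ , _} (inN refl) (_ , y , _) = Zp.+-identityˡ y

  b^c^-coords : ∀ y w → (b ^ toℕ y) · (c ^ toℕ w) ≡ (0p , y , w)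
  b^c^-coords y w = begin
    (b ^ toℕ y) · (c ^ toℕ w)      ≡⟨ cong₂ _·_ (b^toℕ y) (c^toℕ w) ⟩
    (0p , y , 0p) · (0p , 0p , w)  ≡⟨ ≡-triple (Zp.+-identityˡ 0p) (Zp.+-identityʳ y)
                                        (solve 2 (λ y w → zᴾ ((o , y , o) ·ᴾ (o , o , w)) := w) refl y w) ⟩
    (0p , y , w)                   ∎
    where open ≡-Reasoning

  WC-·a^ : ∀ k i → WC (k · (a ^ i)) ≡ WC k
  WC-·a^ (x , y , z) i = trans (cong (λ h → WC ((x , y , z) · h)) (a^-coords i))
    (solve 4 (λ x y z i → Wᴾ ((x , y , z) ·ᴾ (i , o , o)) := Wᴾ (x , y , z)) refl x y z [ i ])

  WC-c⁻¹ : ∀ k → WC ((c ⁻¹) · k) ≡ WC k ⊕ (⊖ 1p)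
  WC-c⁻¹ (x , y , z) = solve 3 (λ x y z → Wᴾ (cᴾ ⁻¹ᴾ ·ᴾ (x , y , z)) := Wᴾ (x , y , z) :+ (:- ı)) refl x y z

  a-fixes-row₀ : ∀ {F} → IsCosetFun F → ∀ {k} → yC k ≡ 0p → F (((a ⁻¹) ⁻¹) · k) ≡ F k
  a-fixes-row₀ F-coset {x , _ , z} refl = coset-fun-≡ F-coset
    (solve 2 (λ x z → yᴾ ((aᴾ ⁻¹ᴾ) ⁻¹ᴾ ·ᴾ (x , o , z)) := o) refl x z)
    (solve 2 (λ x z → Wᴾ ((aᴾ ⁻¹ᴾ) ⁻¹ᴾ ·ᴾ (x , o , z)) := Wᴾ (x , o , z)) refl x z)

  ac-fixes-row₁ : ∀ {F} → IsCosetFun F → ∀ {k} → yC k ≡ 1p → F (((a · c) ⁻¹) · k) ≡ F k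
  ac-fixes-row₁ F-coset {x , _ , z} refl = coset-fun-≡ F-coset
    (solve 2 (λ x z → yᴾ ((aᴾ ·ᴾ cᴾ) ⁻¹ᴾ ·ᴾ (x , ı , z)) := ı) refl x z)
    (solve 2 (λ x z → Wᴾ ((aᴾ ·ᴾ cᴾ) ⁻¹ᴾ ·ᴾ (x , ı , z)) := Wᴾ (x , ı , z)) refl x z)

  a-acts-as-c⁻¹-on-row₁ : ∀ {F} → IsCosetFun F → ∀ {k} → yC k ≡ 1p →
                          F (((a ⁻¹) ⁻¹) · k) ≡ F ((c ⁻¹) · k)
  a-acts-as-c⁻¹-on-row₁ F-coset {x , _ , z} refl = coset-fun-≡ F-coset
    (solve 2 (λ x z → yᴾ ((aᴾ ⁻¹ᴾ) ⁻¹ᴾ ·ᴾ (x , ı , z)) := yᴾ (cᴾ ⁻¹ᴾ ·ᴾ (x , ı , z))) refl x z)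
    (solve 2 (λ x z → Wᴾ ((aᴾ ⁻¹ᴾ) ⁻¹ᴾ ·ᴾ (x , ı , z)) := Wᴾ (cᴾ ⁻¹ᴾ ·ᴾ (x , ı , z))) refl x z)

  a⁻¹-acts-as-c^y : ∀ {F} → IsCosetFun F → ∀ k → F ((a ⁻¹) · k) ≡ F ((c ^ toℕ (yC k)) · k)
  a⁻¹-acts-as-c^y {F} F-coset (x , y , z) = trans (coset-fun-≡ F-coset
    (solve 3 (λ x y z → yᴾ (aᴾ ⁻¹ᴾ ·ᴾ (x , y , z)) := yᴾ ((o , o , y) ·ᴾ (x , y , z))) refl x y z)
    (solve 3 (λ x y z → Wᴾ (aᴾ ⁻¹ᴾ ·ᴾ (x , y , z)) := Wᴾ ((o , o , y) ·ᴾ (x , y , z))) refl x y z))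
    (cong (λ g → F (g · (x , y , z))) (sym (c^toℕ y)))

  0F : Fun
  0F _ = + 0

  infix 4 _≃_
  record _≃_ (f g : Fun) : Set where
    constructor differ-by
    field
      offset : ℤ
      at     : ∀ k → f k ≡ g k + offset
  open _≃_

  ≈J⇒≃ : ∀ f g → f ≈J g → f ≃ g
  ≈J⇒≃ f g (m , f-g≡m) = differ-by m (λ k →
    trans (sym (restore (f k) (g k))) (cong (λ i → g k + i) (f-g≡m k)))
    where restore : ∀ i j → j + (i - j) ≡ i
          restore = solve-∀

  ≃⇒≈J : ∀ {f g} → f ≃ g → f ≈J g
  ≃⇒≈J {f} {g} (differ-by m f≡g+m) = m , λ k → trans (cong (λ i → i - g k) (f≡g+m k)) (cancel (g k) m)
    where cancel : ∀ i m → (i + m) - i ≡ m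
          cancel = solve-∀

  ≗⇒≃ : ∀ {f g} → (∀ k → f k ≡ g k) → f ≃ g
  ≗⇒≃ {f} {g} f≗g = differ-by (+ 0) (λ k → trans (f≗g k) (sym (ℤ.+-identityʳ (g k))))

  ≃-refl : ∀ {f} → f ≃ f
  ≃-refl = ≗⇒≃ (λ _ → refl)

  ≃-sym : ∀ {f g} → f ≃ g → g ≃ f
  ≃-sym {f} {g} (differ-by m f≡g+m) = differ-by (- m) (λ k →
    trans (sym (cancel (g k) m)) (cong (λ i → i + - m) (sym (f≡g+m k))))
    where cancel : ∀ i m → (i + m) + - m ≡ i
          cancel = solve-∀

  ≃-trans : ∀ {f g h} → f ≃ g → g ≃ h → f ≃ h
  ≃-trans {f} {g} {h} (differ-by m f≡g+m) (differ-by n g≡h+n) =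
    differ-by (n + m) (λ k → trans (f≡g+m k) (trans (cong (λ i → i + m) (g≡h+n k)) (ℤ.+-assoc (h k) n m)))

  J-setoid : Setoid 0ℓ 0ℓ
  J-setoid = record
    { Carrier = Fun
    ; _≈_ = _≃_
    ; isEquivalence = record { refl = ≃-refl ; sym = ≃-sym ; trans = ≃-trans }
    }

  +F-cong : ∀ {f f′ g g′} → f ≃ f′ → g ≃ g′ → (f +F g) ≃ (f′ +F g′)
  +F-cong {f} {f′} {g} {g′} (differ-by m eq) (differ-by n eq′) =
    differ-by (m + n) (λ k → trans (cong₂ _+_ (eq k) (eq′ k)) (regroup (f′ k) (g′ k) m n))
    where regroup : ∀ i j m n → (i + m) + (j + n) ≡ (i + j) + (m + n)
          regroup = solve-∀

  •-cong : ∀ g {f f′} → f ≃ f′ → (g • f) ≃ (g • f′)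
  •-cong g (differ-by m eq) = differ-by m (λ k → eq ((g ⁻¹) · k))

  •-· : ∀ g h f k → (g • (h • f)) k ≡ ((g · h) • f) k
  •-· g h f k = cong f (⁻¹-·-act g h k)

  •-e : ∀ f k → (e • f) k ≡ f k
  •-e f k = cong f (e⁻¹-act k)

  •-coset : ∀ g {f} → IsCosetFun f → IsCosetFun (g • f)
  •-coset g {f} f-coset k h h∈H = trans (cong f (sym (·-assoc (g ⁻¹) k h))) (f-coset _ h h∈H)

  +F-coset : ∀ {f g} → IsCosetFun f → IsCosetFun g → IsCosetFun (f +F g)
  +F-coset f-coset g-coset k h h∈H = cong₂ _+_ (f-coset k h h∈H) (g-coset k h h∈H)

  -F-coset : ∀ {f g} → IsCosetFun f → IsCosetFun g → IsCosetFun (f -F g)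
  -F-coset f-coset g-coset k h h∈H = cong₂ _-_ (f-coset k h h∈H) (g-coset k h h∈H)

  ≃0F⇒constant : ∀ {f} → f ≃ 0F → ∀ k k′ → f k ≡ f k′
  ≃0F⇒constant (differ-by m eq) k k′ = trans (eq k) (sym (eq k′))

  ≃⇒-F≃0F : ∀ {f g} → f ≃ g → (f -F g) ≃ 0F
  ≃⇒-F≃0F {f} {g} (differ-by m eq) = differ-by m (λ k → trans (cong (λ i → i - g k) (eq k)) (cancel (g k) m))
    where cancel : ∀ i m → (i + m) - i ≡ + 0 + m
          cancel = solve-∀

  orbitSum : G → Fun → ℕ → Fun
  orbitSum g r zero    = 0F
  orbitSum g r (suc m) = r +F (g • orbitSum g r m)

  orbitSum-coset : ∀ g {r} → IsCosetFun r → ∀ m → IsCosetFun (orbitSum g r m)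
  orbitSum-coset g r-coset zero    k h h∈H = refl
  orbitSum-coset g r-coset (suc m) = +F-coset r-coset (•-coset g (orbitSum-coset g r-coset m))

  orbitSum-fixed : ∀ g r (S : G → Set) →
                   (∀ {k} → S k → S ((g ⁻¹) · k)) → (∀ {k} → S k → r ((g ⁻¹) · k) ≡ r k) →
                   ∀ m {k} → S k → orbitSum g r m k ≡ + m * r k
  orbitSum-fixed g r S S-closed r-fixed zero    {k} k∈S = sym (ℤ.*-zeroˡ (r k))
  orbitSum-fixed g r S S-closed r-fixed (suc m) {k} k∈S = begin
    r k + orbitSum g r m ((g ⁻¹) · k)  ≡⟨ cong (λ i → r k + i) (orbitSum-fixed g r S S-closed r-fixed m (S-closed k∈S)) ⟩
    r k + + m * r ((g ⁻¹) · k)         ≡⟨ cong (λ i → r k + + m * i) (r-fixed k∈S) ⟩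
    r k + + m * r k                    ≡⟨ one-more (r k) (+ m) ⟩
    (+ 1 + + m) * r k                  ∎
    where open ≡-Reasoning
          one-more : ∀ i m → i + m * i ≡ (+ 1 + m) * i
          one-more = solve-∀

  orbitSum-telescope : ∀ g β m k → orbitSum g (β -F (g • β)) m k ≡ β k - β (((g ^ m) ⁻¹) · k)
  orbitSum-telescope g β zero    k = trans (sym (ℤ.+-inverseʳ (β k))) (cong (λ h → β k - β h) (sym (e⁻¹-act k)))
  orbitSum-telescope g β (suc m) k = begin
    (β k - β ((g ⁻¹) · k)) + orbitSum g (β -F (g • β)) m ((g ⁻¹) · k)
      ≡⟨ cong (λ i → (β k - β ((g ⁻¹) · k)) + i) (orbitSum-telescope g β m ((g ⁻¹) · k)) ⟩
    (β k - β ((g ⁻¹) · k)) + (β ((g ⁻¹) · k) - β (((g ^ m) ⁻¹) · ((g ⁻¹) · k)))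
      ≡⟨ telescope (β k) (β ((g ⁻¹) · k)) _ ⟩
    β k - β (((g ^ m) ⁻¹) · ((g ⁻¹) · k))
      ≡⟨ cong (λ h → β k - β h) (trans (⁻¹-·-act g (g ^ m) k) (cong (λ h → (h ⁻¹) · k) (^-comm g m))) ⟩
    β k - β ((((g ^ m) · g) ⁻¹) · k) ∎
    where open ≡-Reasoning
          telescope : ∀ i j l → (i - j) + (j - l) ≡ i - l
          telescope = solve-∀

  orbitSum-F- : ∀ g r r′ m k → orbitSum g (r -F r′) m k ≡ orbitSum g r m k - orbitSum g r′ m k
  orbitSum-F- g r r′ zero    k = refl
  orbitSum-F- g r r′ (suc m) k =
    trans (cong (λ i → (r k - r′ k) + i) (orbitSum-F- g r r′ m ((g ⁻¹) · k))) (regroup (r k) (r′ k) _ _)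
    where regroup : ∀ i j i′ j′ → (i - j) + (i′ - j′) ≡ (i + i′) - (j + j′)
          regroup = solve-∀

  shift≡0 : ∀ {g t m} → g ^ p ≡ e → (∀ k → t ((g ⁻¹) · k) ≡ t k + m) → m ≡ + 0
  shift≡0 {g} {t} {m} g^p≡e shift = ℤ.neg-injective (p*-injective (begin
    + p * - m                       ≡⟨ cong (+ p *_) (step e) ⟨
    + p * (t -F (g • t)) e          ≡⟨ orbitSum-fixed g (t -F (g • t)) (λ _ → ⊤) _ (λ _ → trans (step _) (sym (step _))) p tt ⟨
    orbitSum g (t -F (g • t)) p e   ≡⟨ orbitSum-telescope g t p e ⟩
    t e - t (((g ^ p) ⁻¹) · e)      ≡⟨ cong (λ h → t e - t ((h ⁻¹) · e)) g^p≡e ⟩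
    t e - t ((e ⁻¹) · e)            ≡⟨ cong (λ h → t e - t h) (e⁻¹-act e) ⟩
    t e - t e                       ≡⟨ ℤ.+-inverseʳ (t e) ⟩
    + 0                             ≡⟨ ℤ.*-zeroʳ (+ p) ⟨
    + p * - + 0                     ∎))
    where
      open ≡-Reasoning
      step : ∀ k → (t -F (g • t)) k ≡ - m
      step k = trans (cong (λ i → t k - i) (shift k)) (cancel (t k) m)
        where cancel : ∀ i m → i - (i + m) ≡ - m
              cancel = solve-∀

  J-fixed⇒fixed : ∀ {g t} → g ^ p ≡ e → (g • t) ≃ t → ∀ k → t (g · k) ≡ t k
  J-fixed⇒fixed {g} {t} g^p≡e (differ-by m eq) k = begin
    t (g · k)                       ≡⟨ ℤ.+-identityʳ (t (g · k)) ⟨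
    t (g · k) + + 0                 ≡⟨ cong (λ i → t (g · k) + i) (shift≡0 {t = t} g^p≡e eq) ⟨
    t (g · k) + m                   ≡⟨ eq (g · k) ⟨
    t ((g ⁻¹) · (g · k))            ≡⟨ cong t (\\-leftDividesʳ g k) ⟩
    t k                             ∎
    where open ≡-Reasoning

  fixed-^ : ∀ {g} {t : Fun} → (∀ k → t (g · k) ≡ t k) → ∀ j k → t ((g ^ j) · k) ≡ t k
  fixed-^ {g} {t} fixed zero    k = cong t (·-identityˡ k)
  fixed-^ {g} {t} fixed (suc j) k = trans (cong t (·-assoc (g ^ j) g k)) (trans (fixed-^ fixed j (g · k)) (fixed k))

  J^G≡0 : ∀ {t} → IsCosetFun t → (b • t) ≃ t → (c • t) ≃ t → t ≃ 0F
  J^G≡0 {t} t-coset b-fixes c-fixes = differ-by (t e) (λ k → trans (t≡te k) (sym (ℤ.+-identityˡ (t e))))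
    where
      t≡te : ∀ k → t k ≡ t e
      t≡te k = begin
        t k                                       ≡⟨ coset-fun-base t-coset k ⟩
        t (0p , yC k , WC k)                      ≡⟨ cong t (b^c^-coords (yC k) (WC k)) ⟨
        t ((b ^ yℕ k) · (c ^ toℕ (WC k)))         ≡⟨ fixed-^ {t = t} (J-fixed⇒fixed b^p≡e b-fixes) (yℕ k) _ ⟩
        t (c ^ toℕ (WC k))                        ≡⟨ cong t (·-identityʳ (c ^ toℕ (WC k))) ⟨
        t ((c ^ toℕ (WC k)) · e)                  ≡⟨ fixed-^ {t = t} (J-fixed⇒fixed (InN⇒^p≡e c∈N) c-fixes) (toℕ (WC k)) e ⟩
        t e                                       ∎
        where open ≡-Reasoning

  -- H¹(⟨c⟩, J) and H¹(N, J)

  -- c shifts WC by one along each row; if the c-norm of r is the constant p q, then summing r along the c-orbit from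
  -- the coset with WC = 0 gives a primitive of r − q.
  c-primitive : Fun → ℤ → Fun
  c-primitive r q k = orbitSum c r (toℕ (WC k)) k - + toℕ (WC k) * q

  c-primitive-at : ∀ r q {k w} → toℕ (WC k) ≡ w → c-primitive r q k ≡ orbitSum c r w k - + w * q
  c-primitive-at r q refl = refl

  c-primitive-coset : ∀ {r} q → IsCosetFun r → IsCosetFun (c-primitive r q)
  c-primitive-coset {r} q r-coset k h (i , refl) =
    trans (c-primitive-at r q (cong toℕ (WC-·a^ k i)))
          (trans (cong (λ s → s - + toℕ (WC k) * q) (orbitSum-coset c r-coset (toℕ (WC k)) k (a ^ i) (i , refl)))
                 (sym (c-primitive-at r q refl)))

  c-primitive-step : ∀ {r q} → (∀ k → orbitSum c r p k ≡ + p * q) →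
                     ∀ k → c-primitive r q k ≡ c-primitive r q ((c ⁻¹) · k) + (r k - q)
  c-primitive-step {r} {q} norm k = by-cases (toℕ (WC k)) refl
    where
      k′ = (c ⁻¹) · k
      W′ : ∀ {n} → toℕ (WC k ⊕ (⊖ 1p)) ≡ n → toℕ (WC k′) ≡ n
      W′ = trans (cong toℕ (WC-c⁻¹ k))
      by-cases : ∀ w → toℕ (WC k) ≡ w → c-primitive r q k ≡ c-primitive r q k′ + (r k - q)
      by-cases (suc w) W≡1+w = begin
        c-primitive r q k                                    ≡⟨ c-primitive-at r q W≡1+w ⟩
        (r k + orbitSum c r w k′) - + suc w * q              ≡⟨ regroup (r k) (orbitSum c r w k′) q (+ w) ⟩
        (orbitSum c r w k′ - + w * q) + (r k - q)
          ≡⟨ cong (λ s → s + (r k - q)) (c-primitive-at r q (W′ (toℕ-⊖1-suc W≡1+w))) ⟨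
        c-primitive r q k′ + (r k - q)                       ∎
        where open ≡-Reasoning
              regroup : ∀ i j q w → (i + j) - (+ 1 + w) * q ≡ (j - w * q) + (i - q)
              regroup = solve-∀
      by-cases zero W≡0 = begin
        c-primitive r q k                                    ≡⟨ c-primitive-at r q W≡0 ⟩
        + 0 - + 0 * q
          ≡⟨ wrap (r k) (orbitSum c r (ℕ.pred p) k′) q (+ ℕ.pred p) full-orbit ⟩
        (orbitSum c r (ℕ.pred p) k′ - + ℕ.pred p * q) + (r k - q)
          ≡⟨ cong (λ s → s + (r k - q)) (c-primitive-at r q (W′ (toℕ-⊖1-zero W≡0))) ⟨
        c-primitive r q k′ + (r k - q)                       ∎
        where
          open ≡-Reasoning
          full-orbit : r k + orbitSum c r (ℕ.pred p) k′ ≡ (+ 1 + + ℕ.pred p) * q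
          full-orbit = trans (cong (λ m → orbitSum c r m k) (ℕ.suc-pred p))
                             (trans (norm k) (cong (λ n → + n * q) (sym (ℕ.suc-pred p))))
          wrap : ∀ i j q m → i + j ≡ (+ 1 + m) * q → + 0 - + 0 * q ≡ (j - m * q) + (i - q)
          wrap i j q m i+j≡ = begin
            + 0 - + 0 * q                ≡⟨ ℤ.+-inverseʳ ((+ 1 + m) * q) ⟨
            (+ 1 + m) * q - (+ 1 + m) * q  ≡⟨ cong (λ s → s - (+ 1 + m) * q) i+j≡ ⟨
            (i + j) - (+ 1 + m) * q        ≡⟨ regroup i j q m ⟩
            (j - m * q) + (i - q)          ∎
            where regroup : ∀ i j q m → (i + j) - (+ 1 + m) * q ≡ (j - m * q) + (i - q)
                  regroup = solve-∀

  c-primitive-solves : ∀ {r q} → (∀ k → orbitSum c r p k ≡ + p * q) →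
                       (c-primitive r q -F (c • c-primitive r q)) ≃ r
  c-primitive-solves {r} {q} norm = differ-by (- q) (λ k →
    trans (cong (λ i → i - c-primitive r q ((c ⁻¹) · k)) (c-primitive-step norm k))
          (cancel (c-primitive r q ((c ⁻¹) · k)) (r k) q))
    where cancel : ∀ i j q → (i + (j - q)) - i ≡ j + - q
          cancel = solve-∀

  module N-Cocycle (R : G → Fun) (R-coset : ∀ g → IsCosetFun (R g))
                   (R-cocycle : ∀ {n₁ n₂} → InN n₁ → InN n₂ → R (n₁ · n₂) ≃ (R n₁ +F (n₁ • R n₂))) where

    R-e≃0 : R e ≃ 0F
    R-e≃0 with R-cocycle e∈N e∈N
    ... | differ-by m eq = differ-by (- m) (λ k → doubled (R e k) m (begin
      R e k                       ≡⟨ cong (λ g → R g k) (·-identityˡ e) ⟨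
      R (e · e) k                 ≡⟨ eq k ⟩
      (R e k + (e • R e) k) + m   ≡⟨ cong (λ i → (R e k + i) + m) (•-e (R e) k) ⟩
      (R e k + R e k) + m         ∎))
      where
        open ≡-Reasoning
        doubled : ∀ i m → i ≡ (i + i) + m → i ≡ + 0 + - m
        doubled i m i≡2i+m = trans (sym (id₁ i m)) (trans (cong (λ j → j + (- i + - m)) (sym i≡2i+m)) (id₂ i m))
          where id₁ : ∀ i m → ((i + i) + m) + (- i + - m) ≡ i
                id₁ = solve-∀
                id₂ : ∀ i m → i + (- i + - m) ≡ + 0 + - m
                id₂ = solve-∀

    orbitSum≃R^ : ∀ {g} → InN g → ∀ m → orbitSum g (R g) m ≃ R (g ^ m)
    orbitSum≃R^ g∈N zero = ≃-sym R-e≃0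
    orbitSum≃R^ {g} g∈N (suc m) = begin
      R g +F (g • orbitSum g (R g) m)  ≈⟨ +F-cong (≃-refl {R g}) (•-cong g (orbitSum≃R^ g∈N m)) ⟩
      R g +F (g • R (g ^ m))           ≈⟨ R-cocycle g∈N (InN-^ g∈N m) ⟨
      R (g · (g ^ m))                  ≡⟨ cong R (^-comm g m) ⟩
      R ((g ^ m) · g)                  ∎
      where open SetoidReasoning J-setoid

    norm-constant : ∀ {g} → InN g → ∀ k k′ → orbitSum g (R g) p k ≡ orbitSum g (R g) p k′
    norm-constant {g} g∈N =
      ≃0F⇒constant (≃-trans (orbitSum≃R^ g∈N p) (subst (λ h → R h ≃ 0F) (sym (InN⇒^p≡e g∈N)) R-e≃0))

    norm-on-fixed-row : ∀ {g y₀} → InN g → (∀ {k} → yC k ≡ y₀ → R g ((g ⁻¹) · k) ≡ R g k) →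
                        ∀ {k} → yC k ≡ y₀ → orbitSum g (R g) p k ≡ + p * R g k
    norm-on-fixed-row {g} {y₀} g∈N fixed =
      orbitSum-fixed g (R g) (λ k → yC k ≡ y₀) (λ {k} k∈row → trans (yC-N· (InN-⁻¹ g∈N) k) k∈row) fixed p

    -- g₂ fixes row 0 and g₃ fixes row 1 pointwise, while c = g₂ · g₃ and g₂ acts on row 1 as c does; comparing
    -- the norms of R g₂, R g₃ and R c on these rows shows that the norm of R c is divisible by p.
    g₂ g₃ : G
    g₂ = a ⁻¹
    g₃ = a · c

    g₂∈N : InN g₂
    g₂∈N = InN-⁻¹ a∈N

    g₃∈N : InN g₃
    g₃∈N = InN-· a∈N c∈N

    u : ℤ
    u = R g₃ b

    R-g₃-row₁ : ∀ {k} → yC k ≡ 1p → R g₃ k ≡ u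
    R-g₃-row₁ {k} k∈row₁ =
      p*-injective (trans (sym (norm₃ k∈row₁)) (trans (norm-constant g₃∈N k b) (norm₃ refl)))
      where norm₃ = norm-on-fixed-row g₃∈N (ac-fixes-row₁ (R-coset g₃))

    ν : ℤ
    ν = offset (R-cocycle g₂∈N g₃∈N)

    R-c-row₁ : ∀ {k} → yC k ≡ 1p → R c k ≡ (R g₂ k + u) + ν
    R-c-row₁ {k} k∈row₁ = begin
      R c k                              ≡⟨ cong (λ g → R g k) (\\-leftDividesʳ a c) ⟨
      R (g₂ · g₃) k                      ≡⟨ at (R-cocycle g₂∈N g₃∈N) k ⟩
      (R g₂ k + R g₃ ((g₂ ⁻¹) · k)) + ν
        ≡⟨ cong (λ i → (R g₂ k + i) + ν) (R-g₃-row₁ (trans (yC-N· (InN-⁻¹ g₂∈N) k) k∈row₁)) ⟩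
      (R g₂ k + u) + ν                   ∎
      where open ≡-Reasoning

    orbitSum-c-row₁ : ∀ m {k} → yC k ≡ 1p → orbitSum c (R c) m k ≡ orbitSum g₂ (R g₂) m k + + m * (u + ν)
    orbitSum-c-row₁ zero    k∈row₁ = sym (ℤ.*-zeroˡ (u + ν))
    orbitSum-c-row₁ (suc m) {k} k∈row₁ = begin
      R c k + orbitSum c (R c) m ((c ⁻¹) · k)
        ≡⟨ cong₂ _+_ (R-c-row₁ k∈row₁) (orbitSum-c-row₁ m (trans (yC-N· (InN-⁻¹ c∈N) k) k∈row₁)) ⟩
      ((R g₂ k + u) + ν) + (orbitSum g₂ (R g₂) m ((c ⁻¹) · k) + + m * (u + ν))
        ≡⟨ cong (λ i → ((R g₂ k + u) + ν) + (i + + m * (u + ν)))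
                (a-acts-as-c⁻¹-on-row₁ (orbitSum-coset g₂ (R-coset g₂) m) k∈row₁) ⟨
      ((R g₂ k + u) + ν) + (orbitSum g₂ (R g₂) m ((g₂ ⁻¹) · k) + + m * (u + ν))
        ≡⟨ regroup (R g₂ k) (orbitSum g₂ (R g₂) m ((g₂ ⁻¹) · k)) u ν (+ m) ⟩
      (R g₂ k + orbitSum g₂ (R g₂) m ((g₂ ⁻¹) · k)) + (+ 1 + + m) * (u + ν) ∎
      where open ≡-Reasoning
            regroup : ∀ i j u ν m → ((i + u) + ν) + (j + m * (u + ν)) ≡ (i + j) + (+ 1 + m) * (u + ν)
            regroup = solve-∀

    q : ℤ
    q = (R g₂ e + u) + ν

    norm-c : ∀ k → orbitSum c (R c) p k ≡ + p * q
    norm-c k = begin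
      orbitSum c (R c) p k                    ≡⟨ norm-constant c∈N k b ⟩
      orbitSum c (R c) p b                    ≡⟨ orbitSum-c-row₁ p refl ⟩
      orbitSum g₂ (R g₂) p b + + p * (u + ν)  ≡⟨ cong (λ i → i + + p * (u + ν)) (norm-constant g₂∈N b e) ⟩
      orbitSum g₂ (R g₂) p e + + p * (u + ν)
        ≡⟨ cong (λ i → i + + p * (u + ν)) (norm-on-fixed-row g₂∈N (a-fixes-row₀ (R-coset g₂)) refl) ⟩
      + p * R g₂ e + + p * (u + ν)            ≡⟨ factor (+ p) (R g₂ e) u ν ⟩
      + p * q                                 ∎
      where open ≡-Reasoning
            factor : ∀ P i u ν → P * i + P * (u + ν) ≡ P * ((i + u) + ν)
            factor = solve-∀

    β : Fun
    β = c-primitive (R c) q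

    β-coset : IsCosetFun β
    β-coset = c-primitive-coset q (R-coset c)

    Solves : G → Set
    Solves g = (β -F (g • β)) ≃ R g

    solves-c : Solves c
    solves-c = c-primitive-solves norm-c

    -- D is c-invariant because a and c commute, hence a-invariant because a acts on each row as a power of c,
    -- and then p · D is the negated (constant) norm of R a.
    D : Fun
    D = (β -F (a • β)) -F R a

    D-coset : IsCosetFun D
    D-coset = -F-coset (-F-coset β-coset (•-coset a β-coset)) (R-coset a)

    ν₁ ν₂ : ℤ
    ν₁ = offset (R-cocycle a∈N c∈N)
    ν₂ = offset (R-cocycle c∈N a∈N)

    ac≡ca : a · c ≡ c · a
    ac≡ca = ≡-triple (Zp.+-comm 1p 0p) (Zp.+-comm 0p 0p) (solve 0 (zᴾ (aᴾ ·ᴾ cᴾ) := zᴾ (cᴾ ·ᴾ aᴾ)) refl)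

    D-c-shift : ∀ k → D ((c ⁻¹) · k) ≡ D k + (ν₂ - ν₁)
    D-c-shift k = begin
      D k′                                              ≡⟨ ℤ.+-identityʳ (D k′) ⟨
      D k′ + + 0                                        ≡⟨ cong (λ i → D k′ + i) (ℤ.+-inverseʳ Rca) ⟨
      D k′ + (Rca - Rca)                                ≡⟨ cong (λ i → D k′ + (Rca - i)) Rca≡Rac ⟩
      D k′ + (Rca - ((R a k + R c ((a ⁻¹) · k)) + ν₁))
        ≡⟨ regroup (β k′) (β ((a ⁻¹) · k′)) (R c k) (R c ((a ⁻¹) · k)) (R a k) (R a k′) q ν₁ ν₂ ⟩
      ((β k′ + (R c k - q)) - (β ((a ⁻¹) · k′) + (R c ((a ⁻¹) · k) - q)) - R a k) + (ν₂ - ν₁)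
        ≡⟨ cong₂ (λ i j → ((i - j) - R a k) + (ν₂ - ν₁)) (c-primitive-step norm-c k) β-a⁻¹k ⟨
      D k + (ν₂ - ν₁)                                   ∎
      where
        open ≡-Reasoning
        k′ = (c ⁻¹) · k
        Rca = (R c k + R a k′) + ν₂
        Rca≡Rac : Rca ≡ (R a k + R c ((a ⁻¹) · k)) + ν₁
        Rca≡Rac = trans (sym (at (R-cocycle c∈N a∈N) k)) (trans (cong (λ g → R g k) (sym ac≡ca)) (at (R-cocycle a∈N c∈N) k))
        β-a⁻¹k : β ((a ⁻¹) · k) ≡ β ((a ⁻¹) · k′) + (R c ((a ⁻¹) · k) - q)
        β-a⁻¹k = trans (c-primitive-step norm-c ((a ⁻¹) · k)) (cong (λ h → β h + (R c ((a ⁻¹) · k) - q)) c⁻¹a⁻¹≡a⁻¹c⁻¹)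
          where c⁻¹a⁻¹≡a⁻¹c⁻¹ : (c ⁻¹) · ((a ⁻¹) · k) ≡ (a ⁻¹) · k′
                c⁻¹a⁻¹≡a⁻¹c⁻¹ = trans (⁻¹-·-act a c k) (trans (cong (λ g → (g ⁻¹) · k) ac≡ca) (sym (⁻¹-·-act c a k)))
        regroup : ∀ B₁ B₂ X Y Ra Ra′ q ν₁ ν₂ →
                  ((B₁ - B₂) - Ra′) + (((X + Ra′) + ν₂) - ((Ra + Y) + ν₁)) ≡
                  ((B₁ + (X - q)) - (B₂ + (Y - q)) - Ra) + (ν₂ - ν₁)
        regroup = solve-∀

    D-fixed-by-c : ∀ k → D (c · k) ≡ D k
    D-fixed-by-c = J-fixed⇒fixed (InN⇒^p≡e c∈N) (differ-by (ν₂ - ν₁) D-c-shift)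

    D-fixed-by-a⁻¹ : ∀ k → D ((a ⁻¹) · k) ≡ D k
    D-fixed-by-a⁻¹ k = trans (a⁻¹-acts-as-c^y D-coset k) (fixed-^ {t = D} D-fixed-by-c (toℕ (yC k)) k)

    p*D≡-norm : ∀ k → + p * D k ≡ - orbitSum a (R a) p e
    p*D≡-norm k = begin
      + p * D k                             ≡⟨ orbitSum-fixed a D (λ _ → ⊤) _ (λ _ → D-fixed-by-a⁻¹ _) p tt ⟨
      orbitSum a D p k                      ≡⟨ orbitSum-F- a (β -F (a • β)) (R a) p k ⟩
      orbitSum a (β -F (a • β)) p k - orbitSum a (R a) p k
        ≡⟨ cong₂ _-_ (orbitSum-telescope a β p k) (norm-constant a∈N k e) ⟩
      (β k - β (((a ^ p) ⁻¹) · k)) - norm   ≡⟨ cong (λ h → (β k - β ((h ⁻¹) · k)) - norm) (InN⇒^p≡e a∈N) ⟩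
      (β k - β ((e ⁻¹) · k)) - norm         ≡⟨ cong (λ h → (β k - β h) - norm) (e⁻¹-act k) ⟩
      (β k - β k) - norm                    ≡⟨ cong (λ i → i - norm) (ℤ.+-inverseʳ (β k)) ⟩
      + 0 - norm                            ≡⟨ ℤ.+-identityˡ (- norm) ⟩
      - norm                                ∎
      where open ≡-Reasoning
            norm = orbitSum a (R a) p e

    D-constant : ∀ k → D k ≡ D e
    D-constant k = p*-injective {D k} {D e} (trans (p*D≡-norm k) (sym (p*D≡-norm e)))

    βa-split : ∀ k → (β -F (a • β)) k ≡ R a k + D k
    βa-split k = sym (restore ((β -F (a • β)) k) (R a k))
      where restore : ∀ i j → j + (i - j) ≡ i
            restore = solve-∀

    solves-a : Solves a
    solves-a = differ-by (D e) (λ k → trans (βa-split k) (cong (λ i → R a k + i) (D-constant k)))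

    solves-e : Solves e
    solves-e = ≃-trans (≗⇒≃ λ k → trans (cong (λ i → β k - i) (•-e β k)) (ℤ.+-inverseʳ (β k))) (≃-sym R-e≃0)

    solves-· : ∀ {g h} → InN g → InN h → Solves g → Solves h → Solves (g · h)
    solves-· {g} {h} g∈N h∈N solves-g solves-h = begin
      β -F ((g · h) • β)                         ≈⟨ ≗⇒≃ split ⟩
      (β -F (g • β)) +F (g • (β -F (h • β)))     ≈⟨ +F-cong solves-g (•-cong g solves-h) ⟩
      R g +F (g • R h)                           ≈⟨ R-cocycle g∈N h∈N ⟨
      R (g · h)                                  ∎
      where
        open SetoidReasoning J-setoid
        split : ∀ k → β k - β (((g · h) ⁻¹) · k) ≡
                      (β k - β ((g ⁻¹) · k)) + (β ((g ⁻¹) · k) - β ((h ⁻¹) · ((g ⁻¹) · k)))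
        split k = trans (cong (λ l → β k - β l) (sym (⁻¹-·-act g h k)))
                        (sym (telescope (β k) (β ((g ⁻¹) · k)) (β ((h ⁻¹) · ((g ⁻¹) · k)))))
          where telescope : ∀ i j l → (i - j) + (j - l) ≡ i - l
                telescope = solve-∀

    solves-^ : ∀ {g} → InN g → Solves g → ∀ m → Solves (g ^ m)
    solves-^ g∈N solves-g zero    = solves-e
    solves-^ g∈N solves-g (suc m) = solves-· (InN-^ g∈N m) g∈N (solves-^ g∈N solves-g m) solves-g

    solves-N : ∀ {n} → InN n → Solves n
    solves-N n∈N = let (i , j , n≡aⁱcʲ) = InN⇒InH'₀ n∈N in
      subst Solves (sym n≡aⁱcʲ)
            (solves-· (InN-^ a∈N i) (InN-^ c∈N j) (solves-^ a∈N solves-a i) (solves-^ c∈N solves-c j))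

  -- The extension of G by J defined by a 2-cocycle

  module Extension (f : 2Cochain) (f-cocycle : ∀ g₁ g₂ g₃ → δ₂ f g₁ g₂ g₃ ≃ 0F) (f-ee : f e e ≃ 0F) where

    κ : G → G → G → ℤ
    κ g₁ g₂ g₃ = offset (f-cocycle g₁ g₂ g₃)

    cocycle-at : ∀ g₁ g₂ g₃ k {k′ g₁₂ g₂₃} → (g₁ ⁻¹) · k ≡ k′ → g₁ · g₂ ≡ g₁₂ → g₂ · g₃ ≡ g₂₃ →
                 ((f g₂ g₃ k′ - f g₁₂ g₃ k) + f g₁ g₂₃ k) - f g₁ g₂ k ≡ κ g₁ g₂ g₃
    cocycle-at g₁ g₂ g₃ k refl refl refl = trans (at (f-cocycle g₁ g₂ g₃) k) (ℤ.+-identityˡ _)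

    f-e· : ∀ g → f e g ≃ 0F
    f-e· g = differ-by (κ e e g + offset f-ee) (λ k →
      trans (isolate (f e g k) (f e e k) (cocycle-at e e g k (e⁻¹-act k) (·-identityˡ e) (·-identityˡ g)))
            (trans (cong (λ i → κ e e g + i) (trans (at f-ee k) (ℤ.+-identityˡ _))) (sym (ℤ.+-identityˡ _))))
      where isolate : ∀ i j {κ} → ((i - i) + i) - j ≡ κ → i ≡ κ + j
            isolate i j refl = identity i j
              where identity : ∀ i j → i ≡ (((i - i) + i) - j) + j
                    identity = solve-∀

    f-·e : ∀ g → f g e ≃ 0F
    f-·e g = differ-by (offset f-ee - κ g e e) (λ k →
      trans (isolate (f g e k) (f e e ((g ⁻¹) · k)) (cocycle-at g e e k refl (·-identityʳ g) (·-identityˡ e)))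
            (trans (cong (λ i → i - κ g e e) (trans (at f-ee _) (ℤ.+-identityˡ (offset f-ee)))) (sym (ℤ.+-identityˡ _))))
      where isolate : ∀ i j {κ} → ((j - i) + i) - i ≡ κ → i ≡ j - κ
            isolate i j refl = identity i j
              where identity : ∀ i j → i ≡ j - (((j - i) + i) - i)
                    identity = solve-∀

    record E : Set where
      constructor ⟨_,_⟩
      field
        J-part : Fun
        G-part : G
    open E public

    1E : E
    1E = ⟨ 0F , e ⟩

    infix 4 _≈E_
    record _≈E_ (X Y : E) : Set where
      constructor _,_
      field
        J-≃ : J-part X ≃ J-part Y
        G-≡ : G-part X ≡ G-part Y
    open _≈E_ public

    E-setoid : Setoid 0ℓ 0ℓ
    E-setoid = record
      { Carrier = E
      ; _≈_ = _≈E_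
      ; isEquivalence = record
        { refl  = ≃-refl , refl
        ; sym   = λ (α≃ , g≡) → ≃-sym α≃ , sym g≡
        ; trans = λ (α≃ , g≡) (β≃ , h≡) → ≃-trans α≃ β≃ , trans g≡ h≡
        }
      }

    open Setoid E-setoid public
      using () renaming (refl to ≈E-refl; sym to ≈E-sym; trans to ≈E-trans; reflexive to ≡⇒≈E)

    -- Opaque because unfolding it lets the normaliser expand nested products in G, which makes checking blow up.
    opaque
      infixl 7 _⊛_
      _⊛_ : E → E → E
      ⟨ α , g ⟩ ⊛ ⟨ α′ , h ⟩ = ⟨ (α +F (g • α′)) +F f g h , g · h ⟩

    opaque
      unfolding _⊛_

      ⊛-cong : ∀ {X X′ Y Y′} → X ≈E X′ → Y ≈E Y′ → X ⊛ Y ≈E X′ ⊛ Y′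
      ⊛-cong {⟨ α , g ⟩} {⟨ α′ , .g ⟩} {⟨ β , h ⟩} {⟨ β′ , .h ⟩} (α≃ , refl) (β≃ , refl) =
        +F-cong (+F-cong α≃ (•-cong g β≃)) (≃-refl {f g h}) , refl

      ⊛-assoc : ∀ X Y Z → (X ⊛ Y) ⊛ Z ≈E X ⊛ (Y ⊛ Z)
      ⊛-assoc ⟨ α , g ⟩ ⟨ β , h ⟩ ⟨ γ , l ⟩ = differ-by (- κ g h l) (λ k →
        trans (cong (λ i → (((α k + β ((g ⁻¹) · k)) + f g h k) + i) + f (g · h) l k) (sym (•-· g h γ k)))
              (isolate (α k) (β ((g ⁻¹) · k)) (γ ((h ⁻¹) · ((g ⁻¹) · k)))
                       (f g h k) (f (g · h) l k) (f h l ((g ⁻¹) · k)) (f g (h · l) k)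
                       (cocycle-at g h l k refl refl refl)))
        , ·-assoc g h l
        where isolate : ∀ A B Γ F₁ F₂ F₃ F₄ {κ} → ((F₃ - F₂) + F₄) - F₁ ≡ κ →
                        (((A + B) + F₁) + Γ) + F₂ ≡ (A + ((B + Γ) + F₃)) + F₄ + - κ
              isolate A B Γ F₁ F₂ F₃ F₄ refl = identity A B Γ F₁ F₂ F₃ F₄
                where identity : ∀ A B Γ F₁ F₂ F₃ F₄ →
                                 (((A + B) + F₁) + Γ) + F₂ ≡ (A + ((B + Γ) + F₃)) + F₄ + - (((F₃ - F₂) + F₄) - F₁)
                      identity = solve-∀

      ⊛-identityˡ : ∀ X → 1E ⊛ X ≈E X
      ⊛-identityˡ ⟨ α , g ⟩ = differ-by (offset (f-e· g)) (λ k →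
        trans (cong₂ (λ i j → (+ 0 + i) + j) (•-e α k) (at (f-e· g) k)) (regroup (α k) _)) , ·-identityˡ g
        where regroup : ∀ i m → (+ 0 + i) + (+ 0 + m) ≡ i + m
              regroup = solve-∀

      ⊛-identityʳ : ∀ X → X ⊛ 1E ≈E X
      ⊛-identityʳ ⟨ α , g ⟩ = differ-by (offset (f-·e g)) (λ k →
        trans (cong (λ j → (α k + + 0) + j) (at (f-·e g) k)) (regroup (α k) _)) , ·-identityʳ g
        where regroup : ∀ i m → (i + + 0) + (+ 0 + m) ≡ i + m
              regroup = solve-∀

      section⇒coboundary : (s : G → E) → (∀ g → G-part (s g) ≡ g) → (∀ g → IsCosetFun (J-part (s g))) →
                           (∀ g h → s g ⊛ s h ≈E s (g · h)) → IsCoboundaryOnG f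
      section⇒coboundary s s-G s-coset s-hom =
        ψ , ψ-coset , λ g h → ≃⇒≈J (differ-by (offset (J-≃ (s-hom g h))) (f≡δψ g h))
        where
          ψ : 1Cochain
          ψ g k = - J-part (s g) k

          ψ-coset : Is1Cochain ψ
          ψ-coset g k h h∈H = cong -_ (s-coset g k h h∈H)

          f≡δψ : ∀ g h k → f g h k ≡ δ₁ ψ g h k + offset (J-≃ (s-hom g h))
          f≡δψ g h k = isolate (J-part (s g) k) (J-part (s h) ((g ⁻¹) · k)) (f g h k) (J-part (s (g · h)) k) (begin
            (J-part (s g) k + J-part (s h) ((g ⁻¹) · k)) + f g h k
              ≡⟨ cong₂ (λ g′ h′ → (J-part (s g) k + J-part (s h) ((g′ ⁻¹) · k)) + f g′ h′ k) (s-G g) (s-G h) ⟨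
            J-part (s g ⊛ s h) k
              ≡⟨ at (J-≃ (s-hom g h)) k ⟩
            J-part (s (g · h)) k + offset (J-≃ (s-hom g h)) ∎)
            where
              open ≡-Reasoning
              isolate : ∀ A B F C {m} → (A + B) + F ≡ C + m → F ≡ ((- B - - C) + - A) + m
              isolate A B F C {m} eq = trans (identity A B F) (trans (cong (λ X → X - (A + B)) eq) (identity′ A B C m))
                where identity : ∀ A B F → F ≡ ((A + B) + F) - (A + B)
                      identity = solve-∀
                      identity′ : ∀ A B C m → (C + m) - (A + B) ≡ ((- B - - C) + - A) + m
                      identity′ = solve-∀

      central⇒fixed : ∀ {t X} → ⟨ t , e ⟩ ⊛ X ≈E X ⊛ ⟨ t , e ⟩ → (G-part X • t) ≃ t
      central⇒fixed {t} {⟨ α , g ⟩} (differ-by m eq , _) = differ-by ((c₁ - c₂) - m) (λ k →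
        isolate (t k) (α k) (t ((g ⁻¹) · k))
                (trans (cong₂ (λ i j → (t k + i) + j) (sym (•-e α k)) (sym (at (f-e· g) k)))
                       (trans (eq k) (cong (λ j → ((α k + t ((g ⁻¹) · k)) + j) + m) (at (f-·e g) k)))))
        where
          c₁ c₂ : ℤ
          c₁ = offset (f-e· g)
          c₂ = offset (f-·e g)
          isolate : ∀ T A T′ → (T + A) + (+ 0 + c₁) ≡ ((A + T′) + (+ 0 + c₂)) + m → T′ ≡ T + ((c₁ - c₂) - m)
          isolate T A T′ eq = begin
            T′                                                        ≡⟨ identity₁ A T′ c₂ m ⟩
            ((((A + T′) + (+ 0 + c₂)) + m) - A) - ((+ 0 + c₂) + m)    ≡⟨ cong (λ X → (X - A) - ((+ 0 + c₂) + m)) eq ⟨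
            (((T + A) + (+ 0 + c₁)) - A) - ((+ 0 + c₂) + m)            ≡⟨ identity₂ T A c₁ c₂ m ⟩
            T + ((c₁ - c₂) - m)                                       ∎
            where
              open ≡-Reasoning
              identity₁ : ∀ A T′ c₂ m → T′ ≡ ((((A + T′) + (+ 0 + c₂)) + m) - A) - ((+ 0 + c₂) + m)
              identity₁ = solve-∀
              identity₂ : ∀ T A c₁ c₂ m → (((T + A) + (+ 0 + c₁)) - A) - ((+ 0 + c₂) + m) ≡ T + ((c₁ - c₂) - m)
              identity₂ = solve-∀

      G-part-⊛ : ∀ X Y → G-part (X ⊛ Y) ≡ G-part X · G-part Y
      G-part-⊛ X Y = refl

      ⊛-coset : Is2Cochain f → ∀ {X Y} → IsCosetFun (J-part X) → IsCosetFun (J-part Y) → IsCosetFun (J-part (X ⊛ Y))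
      ⊛-coset f-coset {⟨ α , g ⟩} {⟨ α′ , h ⟩} α-coset α′-coset =
        +F-coset (+F-coset α-coset (•-coset g α′-coset)) (f-coset g h)

  -- Cocycles vanishing on N are coboundaries

  module VanishingOnN (f : 2Cochain) (f-coset : Is2Cochain f) (f-cocycle : ∀ g₁ g₂ g₃ → δ₂ f g₁ g₂ g₃ ≃ 0F)
                   (f-N : ∀ {n₁ n₂} → InN n₁ → InN n₂ → f n₁ n₂ ≃ 0F) where

    open Extension f f-cocycle (f-N e∈N e∈N)

    -- b̂ = ⟨ β , b ⟩ satisfies b̂ ⊛ ι (b⁻¹ n b) ≈E ι n ⊛ b̂ exactly when β -F (n • β) ≃ R n.
    R : G → Fun
    R n = f n b -F f b (conj (b ⁻¹) n)

    R-coset : ∀ g → IsCosetFun (R g)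
    R-coset g = -F-coset (f-coset g b) (f-coset b (conj (b ⁻¹) g))

    R-cocycle : ∀ {n₁ n₂} → InN n₁ → InN n₂ → R (n₁ · n₂) ≃ (R n₁ +F (n₁ • R n₂))
    R-cocycle {n₁} {n₂} n₁∈N n₂∈N = differ-by _ (λ k →
      trans (cong (λ m → f (n₁ · n₂) b k - f b m k) (conj-hom (b ⁻¹) n₁ n₂))
            (arith (f (n₁ · n₂) b k) (f b (m₁ · m₂) k) (f n₁ b k) (f b m₁ k) (f n₂ b ((n₁ ⁻¹) · k)) (f b m₂ ((n₁ ⁻¹) · k))
                   (f n₁ (n₂ · b) k) (f n₁ n₂ k) (f m₁ m₂ ((b ⁻¹) · k)) (f (n₁ · b) m₂ k) (offset f-n₁n₂) (offset f-m₁m₂)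
                   (cocycle-at n₁ n₂ b k refl refl refl)
                   (cocycle-at n₁ b m₂ k refl refl (·-conj⁻¹ b n₂))
                   (cocycle-at b m₁ m₂ k refl (·-conj⁻¹ b n₁) refl)
                   (at f-n₁n₂ k)
                   (at f-m₁m₂ ((b ⁻¹) · k))))
      where
        m₁ = conj (b ⁻¹) n₁
        m₂ = conj (b ⁻¹) n₂
        f-n₁n₂ = f-N n₁∈N n₂∈N
        f-m₁m₂ = f-N (InN-conj (b ⁻¹) n₁∈N) (InN-conj (b ⁻¹) n₂∈N)
        arith : ∀ A B C D E F G₁ H I J c₀ c₃ {κ₁ κ₂ κ₃} →
                ((E - A) + G₁) - H ≡ κ₁ → ((F - J) + G₁) - C ≡ κ₂ → ((I - J) + B) - D ≡ κ₃ → H ≡ + 0 + c₀ → I ≡ + 0 + c₃ →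
                A - B ≡ ((C - D) + (E - F)) + ((c₃ - c₀) + ((κ₂ - κ₁) - κ₃))
        arith A B C D E F G₁ _ _ J c₀ c₃ refl refl refl refl refl = identity A B C D E F G₁ J c₀ c₃
          where identity : ∀ A B C D E F G₁ J c₀ c₃ → A - B ≡ ((C - D) + (E - F)) + ((c₃ - c₀) +
                             (((((F - J) + G₁) - C) - (((E - A) + G₁) - (+ 0 + c₀))) - ((((+ 0 + c₃) - J) + B) - D)))
                identity = solve-∀

    open N-Cocycle R R-coset R-cocycle using (β; β-coset; solves-N)

    ι : G → E
    ι n = ⟨ 0F , n ⟩

    b̂ : E
    b̂ = ⟨ β , b ⟩

    b̂^ : ℕ → E
    b̂^ zero    = 1E
    b̂^ (suc y) = b̂^ y ⊛ b̂

    opaque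
      unfolding _⊛_

      ι-hom : ∀ {n₁ n₂} → InN n₁ → InN n₂ → ι n₁ ⊛ ι n₂ ≈E ι (n₁ · n₂)
      ι-hom n₁∈N n₂∈N = differ-by (offset (f-N n₁∈N n₂∈N)) (λ k →
        trans (cong (λ i → (+ 0 + + 0) + i) (at (f-N n₁∈N n₂∈N) k)) (ℤ.+-identityˡ _)) , refl

      b̂-ι : ∀ {n} → InN n → b̂ ⊛ ι n ≈E ι (conj b n) ⊛ b̂
      b̂-ι {n} n∈N = differ-by (offset (solves-N (InN-conj b n∈N))) (λ k →
        isolate (β k) (β ((conj b n ⁻¹) · k)) (f b n k) (f (conj b n) b k)
                (trans (at (solves-N (InN-conj b n∈N)) k)
                       (cong (λ m → (f (conj b n) b k - f b m k) + offset (solves-N (InN-conj b n∈N))) (conj-inverse b n))))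
        , ·-conj b n
        where
          isolate : ∀ B B′ F₁ F₂ {m} → B - B′ ≡ (F₂ - F₁) + m → (B + + 0) + F₁ ≡ ((+ 0 + B′) + F₂) + m
          isolate B B′ F₁ F₂ {m} eq = trans (identity₁ B B′ F₁) (trans (cong (λ X → (X + B′) + F₁) eq) (identity₂ B′ F₁ F₂ m))
            where identity₁ : ∀ B B′ F₁ → (B + + 0) + F₁ ≡ ((B - B′) + B′) + F₁
                  identity₁ = solve-∀
                  identity₂ : ∀ B′ F₁ F₂ m → (((F₂ - F₁) + m) + B′) + F₁ ≡ ((+ 0 + B′) + F₂) + m
                  identity₂ = solve-∀

    G-part-b̂^ : ∀ y → G-part (b̂^ y) ≡ b ^ y
    G-part-b̂^ zero    = refl
    G-part-b̂^ (suc y) = trans (G-part-⊛ (b̂^ y) b̂) (cong (_· b) (G-part-b̂^ y))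

    b̂^-coset : ∀ y → IsCosetFun (J-part (b̂^ y))
    b̂^-coset zero    k h h∈H = refl
    b̂^-coset (suc y) = ⊛-coset f-coset (b̂^-coset y) β-coset

    b̂^-+ : ∀ m n → b̂^ (m ℕ.+ n) ≈E b̂^ m ⊛ b̂^ n
    b̂^-+ m zero = begin
      b̂^ (m ℕ.+ 0)    ≡⟨ cong b̂^ (ℕ.+-identityʳ m) ⟩
      b̂^ m            ≈⟨ ⊛-identityʳ (b̂^ m) ⟨
      b̂^ m ⊛ 1E       ∎
      where open SetoidReasoning E-setoid
    b̂^-+ m (suc n) = begin
      b̂^ (m ℕ.+ suc n)      ≡⟨ cong b̂^ (ℕ.+-suc m n) ⟩
      b̂^ (m ℕ.+ n) ⊛ b̂      ≈⟨ ⊛-cong (b̂^-+ m n) (≈E-refl {b̂}) ⟩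
      (b̂^ m ⊛ b̂^ n) ⊛ b̂     ≈⟨ ⊛-assoc (b̂^ m) (b̂^ n) b̂ ⟩
      b̂^ m ⊛ (b̂^ n ⊛ b̂)     ∎
      where open SetoidReasoning E-setoid

    b̂^-ι : ∀ y {n} → InN n → b̂^ y ⊛ ι n ≈E ι (conj (b ^ y) n) ⊛ b̂^ y
    b̂^-ι zero {n} _ = begin
      1E ⊛ ι n           ≈⟨ ⊛-identityˡ (ι n) ⟩
      ι n                ≡⟨ cong ι (conj-e n) ⟨
      ι (conj e n)       ≈⟨ ⊛-identityʳ (ι (conj e n)) ⟨
      ι (conj e n) ⊛ 1E  ∎
      where open SetoidReasoning E-setoid
    b̂^-ι (suc y) {n} n∈N = begin
      (b̂^ y ⊛ b̂) ⊛ ι n                        ≈⟨ ⊛-assoc (b̂^ y) b̂ (ι n) ⟩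
      b̂^ y ⊛ (b̂ ⊛ ι n)                        ≈⟨ ⊛-cong (≈E-refl {b̂^ y}) (b̂-ι n∈N) ⟩
      b̂^ y ⊛ (ι (conj b n) ⊛ b̂)               ≈⟨ ⊛-assoc (b̂^ y) (ι (conj b n)) b̂ ⟨
      (b̂^ y ⊛ ι (conj b n)) ⊛ b̂               ≈⟨ ⊛-cong (b̂^-ι y (InN-conj b n∈N)) (≈E-refl {b̂}) ⟩
      (ι (conj (b ^ y) (conj b n)) ⊛ b̂^ y) ⊛ b̂ ≈⟨ ⊛-assoc (ι (conj (b ^ y) (conj b n))) (b̂^ y) b̂ ⟩
      ι (conj (b ^ y) (conj b n)) ⊛ (b̂^ y ⊛ b̂) ≡⟨ cong (λ m → ι m ⊛ (b̂^ y ⊛ b̂)) (conj-· (b ^ y) b n) ⟩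
      ι (conj (b ^ suc y) n) ⊛ b̂^ (suc y)      ∎
      where open SetoidReasoning E-setoid

    b̂^p≈1E : b̂^ p ≈E 1E
    b̂^p≈1E = ≈E-trans b̂^p≈t (J^G≡0 (b̂^-coset p) b-fixes-t c-fixes-t , refl)
      where
        open SetoidReasoning E-setoid
        t : Fun
        t = J-part (b̂^ p)
        b̂^p≈t : b̂^ p ≈E ⟨ t , e ⟩
        b̂^p≈t = ≃-refl , trans (G-part-b̂^ p) b^p≡e
        b-fixes-t : (b • t) ≃ t
        b-fixes-t = central⇒fixed (begin
          ⟨ t , e ⟩ ⊛ b̂        ≈⟨ ⊛-cong (≈E-sym b̂^p≈t) (≈E-refl {b̂}) ⟩
          b̂^ (1 ℕ.+ p)         ≈⟨ b̂^-+ 1 p ⟩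
          (1E ⊛ b̂) ⊛ b̂^ p      ≈⟨ ⊛-cong (⊛-identityˡ b̂) b̂^p≈t ⟩
          b̂ ⊛ ⟨ t , e ⟩        ∎)
        c-fixes-t : (c • t) ≃ t
        c-fixes-t = central⇒fixed (begin
          ⟨ t , e ⟩ ⊛ ι c                 ≈⟨ ⊛-cong (≈E-sym b̂^p≈t) (≈E-refl {ι c}) ⟩
          b̂^ p ⊛ ι c                      ≈⟨ b̂^-ι p c∈N ⟩
          ι (conj (b ^ p) c) ⊛ b̂^ p       ≡⟨ cong (λ g → ι (conj g c) ⊛ b̂^ p) b^p≡e ⟩
          ι (conj e c) ⊛ b̂^ p             ≡⟨ cong (λ n → ι n ⊛ b̂^ p) (conj-e c) ⟩
          ι c ⊛ b̂^ p                      ≈⟨ ⊛-cong (≈E-refl {ι c}) b̂^p≈t ⟩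
          ι c ⊛ ⟨ t , e ⟩                 ∎)

    b̂^-multiple : ∀ k → b̂^ (k ℕ.* p) ≈E 1E
    b̂^-multiple zero    = ≈E-refl
    b̂^-multiple (suc k) = begin
      b̂^ (p ℕ.+ k ℕ.* p)       ≈⟨ b̂^-+ p (k ℕ.* p) ⟩
      b̂^ p ⊛ b̂^ (k ℕ.* p)      ≈⟨ ⊛-cong b̂^p≈1E (b̂^-multiple k) ⟩
      1E ⊛ 1E                  ≈⟨ ⊛-identityˡ 1E ⟩
      1E                       ∎
      where open SetoidReasoning E-setoid

    b̂^-mod : ∀ y → b̂^ y ≈E b̂^ (y % p)
    b̂^-mod y = begin
      b̂^ y                               ≡⟨ cong b̂^ (m≡m%n+[m/n]*n y p) ⟩
      b̂^ (y % p ℕ.+ (y / p) ℕ.* p)       ≈⟨ b̂^-+ (y % p) ((y / p) ℕ.* p) ⟩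
      b̂^ (y % p) ⊛ b̂^ ((y / p) ℕ.* p)    ≈⟨ ⊛-cong (≈E-refl {b̂^ (y % p)}) (b̂^-multiple (y / p)) ⟩
      b̂^ (y % p) ⊛ 1E                    ≈⟨ ⊛-identityʳ (b̂^ (y % p)) ⟩
      b̂^ (y % p)                         ∎
      where open SetoidReasoning E-setoid

    section : G → E
    section g = ι (nPart g) ⊛ b̂^ (yℕ g)

    section-G : ∀ g → G-part (section g) ≡ g
    section-G g = trans (G-part-⊛ (ι (nPart g)) (b̂^ (yℕ g)))
                        (trans (cong (nPart g ·_) (G-part-b̂^ (yℕ g))) (nPart-decomposition g))

    section-coset : ∀ g → IsCosetFun (J-part (section g))
    section-coset g = ⊛-coset f-coset {ι (nPart g)} (λ _ _ _ → refl) (b̂^-coset (yℕ g))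

    reorder : ∀ {n₁ n₂} y₁ y₂ → InN n₁ → InN n₂ →
              (ι n₁ ⊛ b̂^ y₁) ⊛ (ι n₂ ⊛ b̂^ y₂) ≈E ι (n₁ · conj (b ^ y₁) n₂) ⊛ b̂^ ((y₁ ℕ.+ y₂) % p)
    reorder {n₁} {n₂} y₁ y₂ n₁∈N n₂∈N = begin
      (ι n₁ ⊛ b̂^ y₁) ⊛ (ι n₂ ⊛ b̂^ y₂)        ≈⟨ ⊛-assoc (ι n₁) (b̂^ y₁) (ι n₂ ⊛ b̂^ y₂) ⟩
      ι n₁ ⊛ (b̂^ y₁ ⊛ (ι n₂ ⊛ b̂^ y₂))        ≈⟨ ⊛-cong (≈E-refl {ι n₁}) (≈E-sym (⊛-assoc (b̂^ y₁) (ι n₂) (b̂^ y₂))) ⟩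
      ι n₁ ⊛ ((b̂^ y₁ ⊛ ι n₂) ⊛ b̂^ y₂)        ≈⟨ ⊛-cong (≈E-refl {ι n₁}) (⊛-cong (b̂^-ι y₁ n₂∈N) (≈E-refl {b̂^ y₂})) ⟩
      ι n₁ ⊛ ((ι n₂′ ⊛ b̂^ y₁) ⊛ b̂^ y₂)       ≈⟨ ⊛-cong (≈E-refl {ι n₁}) (⊛-assoc (ι n₂′) (b̂^ y₁) (b̂^ y₂)) ⟩
      ι n₁ ⊛ (ι n₂′ ⊛ (b̂^ y₁ ⊛ b̂^ y₂))       ≈⟨ ≈E-sym (⊛-assoc (ι n₁) (ι n₂′) (b̂^ y₁ ⊛ b̂^ y₂)) ⟩
      (ι n₁ ⊛ ι n₂′) ⊛ (b̂^ y₁ ⊛ b̂^ y₂)       ≈⟨ ⊛-cong (ι-hom n₁∈N (InN-conj (b ^ y₁) n₂∈N)) (≈E-sym (b̂^-+ y₁ y₂)) ⟩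
      ι (n₁ · n₂′) ⊛ b̂^ (y₁ ℕ.+ y₂)          ≈⟨ ⊛-cong (≈E-refl {ι (n₁ · n₂′)}) (b̂^-mod (y₁ ℕ.+ y₂)) ⟩
      ι (n₁ · n₂′) ⊛ b̂^ ((y₁ ℕ.+ y₂) % p)    ∎
      where
        open SetoidReasoning E-setoid
        n₂′ = conj (b ^ y₁) n₂

    section-reorder : ∀ g h →
                      section g ⊛ section h ≈E ι (nPart g · conj (b ^ yℕ g) (nPart h)) ⊛ b̂^ ((yℕ g ℕ.+ yℕ h) % p)
    section-reorder g h = reorder (yℕ g) (yℕ h) (nPart∈N g) (nPart∈N h)

    nPart-· : ∀ g h → nPart g · conj (b ^ yℕ g) (nPart h) ≡ nPart (g · h)
    nPart-· g h = ∙-cancelʳ (b ^ Y) n (nPart (g · h)) (begin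
      n · (b ^ Y)                               ≡⟨ cong (n ·_) (G-part-b̂^ Y) ⟨
      n · G-part (b̂^ Y)                         ≡⟨ G-part-⊛ (ι n) (b̂^ Y) ⟨
      G-part (ι n ⊛ b̂^ Y)                       ≡⟨ G-≡ (section-reorder g h) ⟨
      G-part (section g ⊛ section h)            ≡⟨ G-part-⊛ (section g) (section h) ⟩
      G-part (section g) · G-part (section h)   ≡⟨ cong₂ _·_ (section-G g) (section-G h) ⟩
      g · h                                     ≡⟨ nPart-decomposition (g · h) ⟨
      nPart (g · h) · (b ^ yℕ (g · h))          ≡⟨ cong (λ y → nPart (g · h) · (b ^ y)) (yℕ-· g h) ⟩
      nPart (g · h) · (b ^ Y)                   ∎)
      where open ≡-Reasoning
            Y = (yℕ g ℕ.+ yℕ h) % p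
            n = nPart g · conj (b ^ yℕ g) (nPart h)

    section-hom : ∀ g h → section g ⊛ section h ≈E section (g · h)
    section-hom g h =
      ≈E-trans (section-reorder g h) (≡⇒≈E (cong₂ (λ n y → ι n ⊛ b̂^ y) (nPart-· g h) (sym (yℕ-· g h))))

    coboundary : IsCoboundaryOnG f
    coboundary = section⇒coboundary section section-G section-coset section-hom

  -- Reduction to cocycles vanishing on N

  _-²_ : 2Cochain → 2Cochain → 2Cochain
  (f -² f′) g h = f g h -F f′ g h

  _+¹_ : 1Cochain → 1Cochain → 1Cochain
  (φ +¹ ψ) g = φ g +F ψ g

  δ₁-coset : ∀ {φ} → Is1Cochain φ → Is2Cochain (δ₁ φ)
  δ₁-coset {φ} φ-coset g h = +F-coset (-F-coset (•-coset g (φ-coset h)) (φ-coset (g · h))) (φ-coset g)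

  δ₁-+¹ : ∀ φ ψ g h k → δ₁ (φ +¹ ψ) g h k ≡ δ₁ φ g h k + δ₁ ψ g h k
  δ₁-+¹ φ ψ g h k = regroup (φ h ((g ⁻¹) · k)) (ψ h ((g ⁻¹) · k)) (φ (g · h) k) (ψ (g · h) k) (φ g k) (ψ g k)
    where regroup : ∀ a a′ b b′ c c′ → ((a + a′) - (b + b′)) + (c + c′) ≡ ((a - b) + c) + ((a′ - b′) + c′)
          regroup = solve-∀

  δ₂--² : ∀ f f′ g₁ g₂ g₃ k → δ₂ (f -² f′) g₁ g₂ g₃ k ≡ δ₂ f g₁ g₂ g₃ k - δ₂ f′ g₁ g₂ g₃ k
  δ₂--² f f′ g₁ g₂ g₃ k = regroup (f g₂ g₃ ((g₁ ⁻¹) · k)) (f′ g₂ g₃ ((g₁ ⁻¹) · k)) (f (g₁ · g₂) g₃ k) (f′ (g₁ · g₂) g₃ k)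
                                  (f g₁ (g₂ · g₃) k) (f′ g₁ (g₂ · g₃) k) (f g₁ g₂ k) (f′ g₁ g₂ k)
    where regroup : ∀ a a′ b b′ c c′ d d′ →
                    (((a - a′) - (b - b′)) + (c - c′)) - (d - d′) ≡ (((a - b) + c) - d) - (((a′ - b′) + c′) - d′)
          regroup = solve-∀

  δ₂-δ₁ : ∀ φ g₁ g₂ g₃ k → δ₂ (δ₁ φ) g₁ g₂ g₃ k ≡ + 0
  δ₂-δ₁ φ g₁ g₂ g₃ k = vanish (φ g₃ ((g₂ ⁻¹) · ((g₁ ⁻¹) · k))) (φ (g₂ · g₃) ((g₁ ⁻¹) · k)) (φ g₂ ((g₁ ⁻¹) · k))
                              (φ g₃ (((g₁ · g₂) ⁻¹) · k)) (φ ((g₁ · g₂) · g₃) k) (φ (g₁ · g₂) k) (φ (g₁ · (g₂ · g₃)) k) (φ g₁ k)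
                              (cong (φ g₃) (⁻¹-·-act g₁ g₂ k)) (cong (λ g → φ g k) (·-assoc g₁ g₂ g₃))
    where vanish : ∀ a b c a′ d e d′ h → a ≡ a′ → d ≡ d′ →
                   ((((a - b) + c) - ((a′ - d) + e)) + ((b - d′) + h)) - ((c - e) + h) ≡ + 0
          vanish a b c _ d e _ h refl refl = identity a b c d e h
            where identity : ∀ a b c d e h → ((((a - b) + c) - ((a - d) + e)) + ((b - d) + h)) - ((c - e) + h) ≡ + 0
                  identity = solve-∀

  kerRes-trivial : KerResTrivial
  kerRes-trivial f (f-coset , f-cocycle) (φ , φ-coset , f≈δφ-on-H'₀) = ψ +¹ φ , ψ+φ-coset , f≈δ[ψ+φ]
    where
      f₁ : 2Cochain
      f₁ = f -² δ₁ φ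

      f₁-coset : Is2Cochain f₁
      f₁-coset g h = -F-coset (f-coset g h) (δ₁-coset φ-coset g h)

      f₁-cocycle : ∀ g₁ g₂ g₃ → δ₂ f₁ g₁ g₂ g₃ ≃ 0F
      f₁-cocycle g₁ g₂ g₃ = ≃-trans (≗⇒≃ δ₂f₁≗δ₂f) (≈J⇒≃ (δ₂ f g₁ g₂ g₃) 0F (f-cocycle g₁ g₂ g₃))
        where δ₂f₁≗δ₂f : ∀ k → δ₂ f₁ g₁ g₂ g₃ k ≡ δ₂ f g₁ g₂ g₃ k
              δ₂f₁≗δ₂f k = trans (δ₂--² f (δ₁ φ) g₁ g₂ g₃ k)
                                 (trans (cong (λ i → δ₂ f g₁ g₂ g₃ k - i) (δ₂-δ₁ φ g₁ g₂ g₃ k)) (ℤ.+-identityʳ _))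

      f₁-N : ∀ {n₁ n₂} → InN n₁ → InN n₂ → f₁ n₁ n₂ ≃ 0F
      f₁-N {n₁} {n₂} n₁∈N n₂∈N =
        ≃⇒-F≃0F (≈J⇒≃ (f n₁ n₂) (δ₁ φ n₁ n₂) (f≈δφ-on-H'₀ n₁ n₂ (InN⇒InH'₀ n₁∈N) (InN⇒InH'₀ n₂∈N)))

      f₁-coboundary : IsCoboundaryOnG f₁
      f₁-coboundary = VanishingOnN.coboundary f₁ f₁-coset f₁-cocycle f₁-N

      ψ : 1Cochain
      ψ = proj₁ f₁-coboundary

      ψ-coset : Is1Cochain ψ
      ψ-coset = proj₁ (proj₂ f₁-coboundary)

      f₁≈δψ : ∀ g h → f₁ g h ≈J δ₁ ψ g h
      f₁≈δψ = proj₂ (proj₂ f₁-coboundary)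

      ψ+φ-coset : Is1Cochain (ψ +¹ φ)
      ψ+φ-coset g = +F-coset (ψ-coset g) (φ-coset g)

      f≈δ[ψ+φ] : ∀ g h → f g h ≈J δ₁ (ψ +¹ φ) g h
      f≈δ[ψ+φ] g h = ≃⇒≈J (begin
        f g h                       ≈⟨ ≗⇒≃ (λ k → sym (restore (f g h k) (δ₁ φ g h k))) ⟩
        f₁ g h +F δ₁ φ g h          ≈⟨ +F-cong (≈J⇒≃ (f₁ g h) (δ₁ ψ g h) (f₁≈δψ g h)) (≃-refl {δ₁ φ g h}) ⟩
        δ₁ ψ g h +F δ₁ φ g h        ≈⟨ ≗⇒≃ (δ₁-+¹ ψ φ g h) ⟨
        δ₁ (ψ +¹ φ) g h             ∎)
        where
          open SetoidReasoning J-setoid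
          restore : ∀ i j → (i - j) + j ≡ i
          restore = solve-∀


proposition2p11 : (p : ℕ) {{nz : NonZero p}} → Prime p → 3 ≤ p → Ep3.KerResTrivial p
proposition2p11 p _ _ = kerRes-trivial p
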